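{- Let $n\in\mathbb{N}_0$ and let $a,c,e$ be complex parameters such that all denominators below are nonzero. Then \[\frac{(a;q)_n(c;q)_n}{(ae;q)_n(qc/e;q)_n} =\sum_{k\ge0}\binom{n}{2k}_q\frac{(1-q^{3k}c)\,q^{3k^2-k}(ac)^k}{(q^na;q)_{k}\,(q^nc;q)_{k+1}}\, \frac{(a;q)_k(q/e;q)_k(ae/c;q)_k\,(c;q)_k(e;q)_k(qc/ae;q)_k}{(ae;q)_{2k}(qc/e;q)_{2k}}\] \[-a\sum_{k\ge0}\binom{n}{2k+1}_q\frac{(1-q^{3k+1}a)\,q^{3k^2+2k}(ac)^k}{(q^na;q)_{k+1}\,(q^nc;q)_{k+1}}\, \frac{(a;q)_k(q/e;q)_k(ae/c;q)_k\,(c;q)_{k+1}(e;q)_{k+1}(qc/ae;q)_{k+1}}{(ae;q)_{2k+1}(qc/e;q)_{2k+1}}.\]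
   Context: For an indeterminate $x$ and $n\in\mathbb{N}_0$, $(x;q)_0=1$ and $(x;q)_n=(1-x)(1-qx)\cdots(1-q^{n-1}x)$. The Gaussian binomial coefficient is $\binom{m}{j}_q=\frac{(q;q)_m}{(q;q)_j(q;q)_{m-j}}$ for $0\le j\le m$ and $\binom{m}{j}_q=0$ for $j>m$ (so the sums are finite). -}

module Defs where

open import Level using (Level; _⊔_)
open import Algebra.Bundles using (CommutativeRing)
open import Data.Nat as ℕ using (ℕ; zero; suc)
open import Relation.Nullary using (¬_)

-- The inverse is given as a total
-- function (its value at 0 is unspecified and never used below).
record Field (c ℓ : Level) : Set (Level.suc (c ⊔ ℓ)) where
  field
    commutativeRing : CommutativeRing c ℓ
  open CommutativeRing commutativeRing public
  field
    _⁻¹       : Carrier → Carrier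
    ⁻¹-cong   : ∀ {x y} → x ≈ y → (x ⁻¹) ≈ (y ⁻¹)
    1≉0       : ¬ (1# ≈ 0#)
    ⁻¹-inverse : ∀ x → ¬ (x ≈ 0#) → (x * (x ⁻¹)) ≈ 1#

  infixl 7 _/_
  _/_ : Carrier → Carrier → Carrier
  x / y = x * (y ⁻¹)

module FieldOps {c ℓ} (F : Field c ℓ) where
  open Field F

  pow : Carrier → ℕ → Carrier
  pow x zero    = 1#
  pow x (suc n) = pow x n * x

  qPoch : Carrier → Carrier → ℕ → Carrier
  qPoch x q zero    = 1#
  qPoch x q (suc n) = qPoch x q n * (1# - pow q n * x)

  -- Gaussian binomial coefficient [m choose j]_q, as a polynomial in q
  -- (q-Pascal rule); it equals (q;q)_m / ((q;q)_j (q;q)_{m-j}) for j ≤ m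
  -- whenever that quotient is defined, and is 0 for j > m.
  qBinom : Carrier → ℕ → ℕ → Carrier
  qBinom q zero    zero    = 1#
  qBinom q zero    (suc j) = 0#
  qBinom q (suc m) zero    = 1#
  qBinom q (suc m) (suc j) = qBinom q m j + pow q (suc j) * qBinom q m (suc j)

  sumTo : ℕ → (ℕ → Carrier) → Carrier
  sumTo zero    f = 0#
  sumTo (suc N) f = sumTo N f + f N

{-# OPTIONS --safe #-}
module Submission where

-- Substituting q = evd, a = vt, c = et makes a, q/e, ae/c, c, e, qc/(ae) and qc/e monomials, so
-- after multiplying by (q^n a; q)_M (q^n c; q)_N (ae; q)_n (qc/e; q)_n the proposition becomes
-- a polynomial identity.  Its left side is (a; q)_{n+M} (c; q)_{n+N}, which only depends on
-- n + M and n + N.  The cleared right side has the same invariance: going from (n + 1, M, N) to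
-- (n, M + 1, N + 1) changes its k-th term by certificate (k + 1) - certificate k, which is
-- checked with the q-Pascal rule and the ratio of consecutive q-binomials, so the sum
-- telescopes.  At n = 0 both sides are (a; q)_M (c; q)_N.

open import Defs
open import Level using (Level)
open import Algebra.Bundles using (CommutativeRing)
open import Algebra.Solver.Ring.AlmostCommutativeRing using (fromCommutativeRing; _-Raw-AlmostCommutative⟶_)
open import Data.Integer as ℤ using (ℤ; +_; -[1+_])
open import Data.Integer.Properties using ([1+m]⊖[1+n]≡m⊖n)
open import Data.Maybe using (Maybe; just; nothing)
open import Data.Nat using (ℕ; zero; suc; _∸_; _≤_; _<_; z≤n; s≤s) renaming (_+_ to _⊕_; _*_ to _⊛_)
import Data.Nat.Properties as ℕ
open import Data.Product using (_×_; _,_)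
open import Data.Sign as Sign using (Sign)
open import Relation.Binary.Definitions using (tri<; tri≈; tri>)
open import Relation.Binary.PropositionalEquality as ≡ using (_≡_)
open import Relation.Nullary using (¬_; yes; no)

-- Algebra.Solver.Ring compares normal forms by evaluation, so its coefficients must compute;
-- ℤ maps homomorphically into every commutative ring and serves as the coefficient ring.
module IntegerCoefficientSolver {ℓ₁ ℓ₂ : Level} (R : CommutativeRing ℓ₁ ℓ₂) where
  open CommutativeRing R
  open import Algebra.Properties.Ring ring
    using (-0#≈0#; -‿+-comm; -‿involutive; -‿distribˡ-*; -‿distribʳ-*; x≈y⇒x∙y⁻¹≈ε)
  open import Algebra.Properties.CommutativeSemigroup +-commutativeSemigroup
    using (interchange)
  open import Algebra.Properties.Semiring.Mult.TCOptimised semiring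
    using (×-homo-+; ×1-homo-*; 1+×) renaming (_×_ to _·_)
  open import Relation.Binary.Reasoning.Setoid setoid

  signed : Sign → Carrier → Carrier
  signed Sign.+ x = x
  signed Sign.- x = - x

  fromℤ : ℤ → Carrier
  fromℤ (+ n)    = n · 1#
  fromℤ -[1+ n ] = - (suc n · 1#)

  fromℤ-signAbs : ∀ i → fromℤ i ≈ signed (ℤ.sign i) (ℤ.∣ i ∣ · 1#)
  fromℤ-signAbs (+ n)    = refl
  fromℤ-signAbs -[1+ n ] = refl

  fromℤ-◃ : ∀ s n → fromℤ (s ℤ.◃ n) ≈ signed s (n · 1#)
  fromℤ-◃ Sign.+ zero    = refl
  fromℤ-◃ Sign.- zero    = sym -0#≈0#
  fromℤ-◃ Sign.+ (suc n) = refl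
  fromℤ-◃ Sign.- (suc n) = refl

  [1+x]-[1+y]≈x-y : ∀ x y → (1# + x) - (1# + y) ≈ x - y
  [1+x]-[1+y]≈x-y x y = begin
    (1# + x) - (1# + y)       ≈⟨ +-congˡ (-‿+-comm 1# y) ⟨
    (1# + x) + (- 1# + - y)   ≈⟨ interchange 1# x (- 1#) (- y) ⟩
    (1# - 1#) + (x - y)       ≈⟨ +-congʳ (-‿inverseʳ 1#) ⟩
    0# + (x - y)              ≈⟨ +-identityˡ _ ⟩
    x - y                     ∎

  fromℤ-⊖ : ∀ m n → fromℤ (m ℤ.⊖ n) ≈ m · 1# - n · 1#
  fromℤ-⊖ m       zero    = sym (trans (+-congˡ -0#≈0#) (+-identityʳ _))
  fromℤ-⊖ zero    (suc n) = sym (+-identityˡ _)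
  fromℤ-⊖ (suc m) (suc n) = begin
    fromℤ (suc m ℤ.⊖ suc n)        ≡⟨ ≡.cong fromℤ ([1+m]⊖[1+n]≡m⊖n m n) ⟩
    fromℤ (m ℤ.⊖ n)                ≈⟨ fromℤ-⊖ m n ⟩
    m · 1# - n · 1#                ≈⟨ [1+x]-[1+y]≈x-y _ _ ⟨
    (1# + m · 1#) - (1# + n · 1#)  ≈⟨ +-cong (1+× m 1#) (-‿cong (1+× n 1#)) ⟨
    suc m · 1# - suc n · 1#        ∎

  fromℤ-+ : ∀ i j → fromℤ (i ℤ.+ j) ≈ fromℤ i + fromℤ j
  fromℤ-+ -[1+ m ] -[1+ n ] = begin
    - (suc (suc m ⊕ n) · 1#)         ≡⟨ ≡.cong (λ k → - (k · 1#)) (ℕ.+-suc (suc m) n) ⟨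
    - ((suc m ⊕ suc n) · 1#)         ≈⟨ -‿cong (×-homo-+ 1# (suc m) (suc n)) ⟩
    - (suc m · 1# + suc n · 1#)      ≈⟨ -‿+-comm _ _ ⟨
    - (suc m · 1#) + - (suc n · 1#)  ∎
  fromℤ-+ -[1+ m ] (+ n)    = trans (fromℤ-⊖ n (suc m)) (+-comm _ _)
  fromℤ-+ (+ m)    -[1+ n ] = fromℤ-⊖ m (suc n)
  fromℤ-+ (+ m)    (+ n)    = ×-homo-+ 1# m n

  fromℤ-neg : ∀ i → fromℤ (ℤ.- i) ≈ - fromℤ i
  fromℤ-neg (+ zero)  = sym -0#≈0#
  fromℤ-neg (+ suc n) = refl
  fromℤ-neg -[1+ n ]  = sym (-‿involutive _)

  signed-cong : ∀ s {x y} → x ≈ y → signed s x ≈ signed s y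
  signed-cong Sign.+ x≈y = x≈y
  signed-cong Sign.- x≈y = -‿cong x≈y

  signed-* : ∀ s t x y → signed (s Sign.* t) (x * y) ≈ signed s x * signed t y
  signed-* Sign.+ Sign.+ x y = refl
  signed-* Sign.+ Sign.- x y = -‿distribʳ-* x y
  signed-* Sign.- Sign.+ x y = -‿distribˡ-* x y
  signed-* Sign.- Sign.- x y = begin
    x * y          ≈⟨ -‿involutive _ ⟨
    - - (x * y)    ≈⟨ -‿cong (-‿distribʳ-* x y) ⟩
    - (x * - y)    ≈⟨ -‿distribˡ-* x (- y) ⟩
    - x * - y      ∎

  fromℤ-* : ∀ i j → fromℤ (i ℤ.* j) ≈ fromℤ i * fromℤ j
  fromℤ-* i j = begin
    fromℤ (s ℤ.◃ ℤ.∣ i ∣ ⊛ ℤ.∣ j ∣)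
      ≈⟨ fromℤ-◃ s (ℤ.∣ i ∣ ⊛ ℤ.∣ j ∣) ⟩
    signed s ((ℤ.∣ i ∣ ⊛ ℤ.∣ j ∣) · 1#)
      ≈⟨ signed-cong s (×1-homo-* ℤ.∣ i ∣ ℤ.∣ j ∣) ⟩
    signed s ((ℤ.∣ i ∣ · 1#) * (ℤ.∣ j ∣ · 1#))
      ≈⟨ signed-* (ℤ.sign i) (ℤ.sign j) _ _ ⟩
    signed (ℤ.sign i) (ℤ.∣ i ∣ · 1#) * signed (ℤ.sign j) (ℤ.∣ j ∣ · 1#)
      ≈⟨ *-cong (fromℤ-signAbs i) (fromℤ-signAbs j) ⟨
    fromℤ i * fromℤ j ∎
    where
    s : Sign
    s = ℤ.sign i Sign.* ℤ.sign j

  fromℤ-homomorphism : ℤ.+-*-rawRing -Raw-AlmostCommutative⟶ fromCommutativeRing R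
  fromℤ-homomorphism = record
    { ⟦_⟧ = fromℤ ; +-homo = fromℤ-+ ; *-homo = fromℤ-* ; -‿homo = fromℤ-neg
    ; 0-homo = refl ; 1-homo = refl }

  fromℤ-≟ : ∀ i j → Maybe (fromℤ i ≈ fromℤ j)
  fromℤ-≟ i j with i ℤ.≟ j
  ... | yes ≡.refl = just refl
  ... | no _       = nothing

  open import Algebra.Solver.Ring ℤ.+-*-rawRing (fromCommutativeRing R) fromℤ-homomorphism fromℤ-≟ public

  :1 : ∀ {m} → Polynomial m
  :1 = con (+ 1)

  -- Syntax for FieldOps.pow: unlike :^, it evaluates to exactly the terms that pow produces.
  infixr 9 _:^ᵖ_
  _:^ᵖ_ : ∀ {m} → Polynomial m → ℕ → Polynomial m
  p :^ᵖ zero  = :1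
  p :^ᵖ suc n = p :^ᵖ n :* p

  -- The solver proves an identity that only holds modulo a relation x ≈ y once it is given
  -- the multiplier k of x - y.
  ≈-modulo : ∀ {l r k x y} → l ≈ r + k * (x - y) → x ≈ y → l ≈ r
  ≈-modulo {l} {r} {k} l≈r+k[x-y] x≈y = begin
    l                ≈⟨ l≈r+k[x-y] ⟩
    r + k * (_ - _)  ≈⟨ +-congˡ (*-congˡ (x≈y⇒x∙y⁻¹≈ε x≈y)) ⟩
    r + k * 0#       ≈⟨ +-congˡ (zeroʳ k) ⟩
    r + 0#           ≈⟨ +-identityʳ r ⟩
    r                ∎

module QSeries {ℓ₁ ℓ₂ : Level} (F : Field ℓ₁ ℓ₂) where
  open Field F hiding (zero)
  open FieldOps F
  open IntegerCoefficientSolver commutativeRing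
  open import Relation.Binary.Reasoning.Setoid setoid

  pow-cong : ∀ n {x y} → x ≈ y → pow x n ≈ pow y n
  pow-cong zero    x≈y = refl
  pow-cong (suc n) x≈y = *-cong (pow-cong n x≈y) x≈y

  pow-+ : ∀ x m n → pow x (m ⊕ n) ≈ pow x m * pow x n
  pow-+ x zero    n = sym (*-identityˡ _)
  pow-+ x (suc m) n = trans (*-congʳ (pow-+ x m n))
    (solve 3 (λ A B y → (A :* B) :* y := (A :* y) :* B) refl (pow x m) (pow x n) x)

  pow-* : ∀ x m n → pow x (m ⊛ n) ≈ pow (pow x n) m
  pow-* x zero    n = refl
  pow-* x (suc m) n = trans (pow-+ x n (m ⊛ n)) (trans (*-comm _ _) (*-congʳ (pow-* x m n)))

  qPoch-cong : ∀ n {x y p r} → x ≈ y → p ≈ r → qPoch x p n ≈ qPoch y r n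
  qPoch-cong zero    x≈y p≈r = refl
  qPoch-cong (suc n) x≈y p≈r =
    *-cong (qPoch-cong n x≈y p≈r) (+-congˡ (-‿cong (*-cong (pow-cong n p≈r) x≈y)))

  qPoch-sucˡ : ∀ x q m → qPoch x q (suc m) ≈ (1# - x) * qPoch (q * x) q m
  qPoch-sucˡ x q zero = solve 1 (λ x → :1 :* (:1 :- :1 :* x) := (:1 :- x) :* :1) refl x
  qPoch-sucˡ x q (suc m) = trans (*-congʳ (qPoch-sucˡ x q m))
    (solve 4 (λ x R p q → ((:1 :- x) :* R) :* (:1 :- (p :* q) :* x) := (:1 :- x) :* (R :* (:1 :- p :* (q :* x))))
      refl x (qPoch (q * x) q m) (pow q m) q)

  qPoch-+ : ∀ x q m n → qPoch x q (m ⊕ n) ≈ qPoch x q m * qPoch (pow q m * x) q n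
  qPoch-+ x q m zero = trans (reflexive (≡.cong (qPoch x q) (ℕ.+-identityʳ m))) (sym (*-identityʳ _))
  qPoch-+ x q m (suc n) = begin
    qPoch x q (m ⊕ suc n)
      ≡⟨ ≡.cong (qPoch x q) (ℕ.+-suc m n) ⟩
    qPoch x q (m ⊕ n) * (1# - pow q (m ⊕ n) * x)
      ≈⟨ *-cong (qPoch-+ x q m n) (+-congˡ (-‿cong (*-congʳ (pow-+ q m n)))) ⟩
    qPoch x q m * qPoch (pow q m * x) q n * (1# - pow q m * pow q n * x)
      ≈⟨ solve 5 (λ A B pm pn x → (A :* B) :* (:1 :- (pm :* pn) :* x) := A :* (B :* (:1 :- pn :* (pm :* x))))
           refl (qPoch x q m) (qPoch (pow q m * x) q n) (pow q m) (pow q n) x ⟩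
    qPoch x q m * qPoch (pow q m * x) q (suc n) ∎

  -- (q^i x; q)_{m ∸ i}, the factors of (x; q)_m from the i-th one on; it is empty when m ≤ i.
  qPochFrom : Carrier → Carrier → ℕ → ℕ → Carrier
  qPochFrom x q i m = qPoch (pow q i * x) q (m ∸ i)

  qPoch-split : ∀ x q {i m} → i ≤ m → qPoch x q m ≈ qPoch x q i * qPochFrom x q i m
  qPoch-split x q {i} {m} i≤m =
    trans (reflexive (≡.cong (qPoch x q) (≡.sym (ℕ.m+[n∸m]≡n i≤m)))) (qPoch-+ x q i (m ∸ i))

  qPochFrom-empty : ∀ x q {i m} → m ≤ i → qPochFrom x q i m ≈ 1#
  qPochFrom-empty x q {i} m≤i = reflexive (≡.cong (qPoch (pow q i * x) q) (ℕ.m≤n⇒m∸n≡0 m≤i))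

  qPochFrom-sucˡ : ∀ x q {i m} → i < m → qPochFrom x q i m ≈ (1# - pow q i * x) * qPochFrom x q (suc i) m
  qPochFrom-sucˡ x q {i} {suc m} (s≤s i≤m) = begin
    qPoch (pow q i * x) q (suc m ∸ i)
      ≡⟨ ≡.cong (qPoch (pow q i * x) q) (ℕ.+-∸-assoc 1 i≤m) ⟩
    qPoch (pow q i * x) q (suc (m ∸ i))
      ≈⟨ qPoch-sucˡ (pow q i * x) q (m ∸ i) ⟩
    (1# - pow q i * x) * qPoch (q * (pow q i * x)) q (m ∸ i)
      ≈⟨ *-congˡ (qPoch-cong (m ∸ i) (solve 3 (λ q p x → q :* (p :* x) := (p :* q) :* x) refl q (pow q i) x)
                                     refl) ⟩
    (1# - pow q i * x) * qPochFrom x q (suc i) (suc m) ∎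

  qPochFrom-sucʳ : ∀ x q {i m} → i ≤ m → qPochFrom x q i (suc m) ≈ qPochFrom x q i m * (1# - pow q m * x)
  qPochFrom-sucʳ x q {i} {m} i≤m = begin
    qPoch (pow q i * x) q (suc m ∸ i)
      ≡⟨ ≡.cong (qPoch (pow q i * x) q) (ℕ.+-∸-assoc 1 i≤m) ⟩
    qPoch (pow q i * x) q (m ∸ i) * (1# - pow q (m ∸ i) * (pow q i * x))
      ≈⟨ *-congˡ (+-congˡ (-‿cong (begin
           pow q (m ∸ i) * (pow q i * x)  ≈⟨ *-assoc _ _ _ ⟨
           pow q (m ∸ i) * pow q i * x    ≈⟨ *-congʳ (pow-+ q (m ∸ i) i) ⟨
           pow q (m ∸ i ⊕ i) * x          ≡⟨ ≡.cong (λ j → pow q j * x) (ℕ.m∸n+n≡m i≤m) ⟩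
           pow q m * x                    ∎))) ⟩
    qPochFrom x q i m * (1# - pow q m * x) ∎

  qPochFrom-shift : ∀ x q n {i m} → i ≤ m →
    qPochFrom (pow q n * x) q i (suc m) ≈ (1# - pow q i * (pow q n * x)) * qPochFrom (pow q (suc n) * x) q i m
  qPochFrom-shift x q n {i} {m} i≤m = begin
    qPochFrom (pow q n * x) q i (suc m)
      ≈⟨ qPochFrom-sucˡ (pow q n * x) q (s≤s i≤m) ⟩
    (1# - pow q i * (pow q n * x)) * qPochFrom (pow q n * x) q (suc i) (suc m)
      ≈⟨ *-congˡ (qPoch-cong (m ∸ i)
           (solve 4 (λ p q r x → (p :* q) :* (r :* x) := p :* ((r :* q) :* x)) refl (pow q i) q (pow q n) x) refl) ⟩
    (1# - pow q i * (pow q n * x)) * qPochFrom (pow q (suc n) * x) q i m ∎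

  qBinom-cong : ∀ n k {p r} → p ≈ r → qBinom p n k ≈ qBinom r n k
  qBinom-cong zero    zero    p≈r = refl
  qBinom-cong zero    (suc k) p≈r = refl
  qBinom-cong (suc n) zero    p≈r = refl
  qBinom-cong (suc n) (suc k) p≈r =
    +-cong (qBinom-cong n k p≈r) (*-cong (pow-cong (suc k) p≈r) (qBinom-cong n (suc k) p≈r))

  qBinom-zero : ∀ q n → qBinom q n 0 ≈ 1#
  qBinom-zero q zero    = refl
  qBinom-zero q (suc n) = refl

  n<k⇒qBinom≈0 : ∀ q {n k} → n < k → qBinom q n k ≈ 0#
  n<k⇒qBinom≈0 q {zero}  {suc k} _         = refl
  n<k⇒qBinom≈0 q {suc n} {suc k} (s≤s n<k) = begin
    qBinom q n k + pow q (suc k) * qBinom q n (suc k)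
      ≈⟨ +-cong (n<k⇒qBinom≈0 q n<k) (*-congˡ (n<k⇒qBinom≈0 q (ℕ.m<n⇒m<1+n n<k))) ⟩
    0# + pow q (suc k) * 0#  ≈⟨ +-identityˡ _ ⟩
    pow q (suc k) * 0#       ≈⟨ zeroʳ _ ⟩
    0#                       ∎

  qBinom-ratio : ∀ q n k → pow q k * (1# - pow q (suc k)) * qBinom q n (suc k) ≈ (pow q k - pow q n) * qBinom q n k
  qBinom-ratio q zero zero = solve 1 (λ q → :1 :* (:1 :- :1 :* q) :* con (+ 0) := (:1 :- :1) :* :1) refl q
  qBinom-ratio q zero (suc k) = trans (zeroʳ _) (sym (zeroʳ _))
  qBinom-ratio q (suc m) zero = ≈-modulo (≈-modulo
    (solve 4 (λ q p b₀ b₁ →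
        :1 :* (:1 :- :1 :* q) :* (b₀ :+ (:1 :* q) :* b₁)
      := (:1 :- p :* q) :* :1
        :+ q :* (:1 :* (:1 :- :1 :* q) :* b₁ :- (:1 :- p) :* b₀)
        :+ (:1 :- p :* q) :* (b₀ :- :1))
      refl q (pow q m) (qBinom q m 0) (qBinom q m 1))
    (qBinom-zero q m)) (qBinom-ratio q m zero)
  qBinom-ratio q (suc m) (suc k) = ≈-modulo (≈-modulo
    (solve 6 (λ y q p b₀ b₁ b₂ →
        (y :* q) :* (:1 :- (y :* q) :* q) :* (b₁ :+ ((y :* q) :* q) :* b₂)
      := (y :* q :- p :* q) :* (b₀ :+ (y :* q) :* b₁)
        :+ (y :* q :* q) :* ((y :* q) :* (:1 :- (y :* q) :* q) :* b₂ :- (y :* q :- p) :* b₁)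
        :+ q :* (y :* (:1 :- y :* q) :* b₁ :- (y :- p) :* b₀))
      refl (pow q k) q (pow q m) (qBinom q m k) (qBinom q m (suc k)) (qBinom q m (suc (suc k))))
    (qBinom-ratio q m k)) (qBinom-ratio q m (suc k))

  sumTo-cong : ∀ N {f g} → (∀ k → k < N → f k ≈ g k) → sumTo N f ≈ sumTo N g
  sumTo-cong zero    f≈g = refl
  sumTo-cong (suc N) f≈g = +-cong (sumTo-cong N (λ k k<N → f≈g k (ℕ.m<n⇒m<1+n k<N))) (f≈g N ℕ.≤-refl)

  sumTo-telescope : ∀ N (f h : ℕ → Carrier) → (∀ k → k < N → f k ≈ h (suc k) - h k) → sumTo N f ≈ h N - h 0
  sumTo-telescope zero    f h f≈Δh = sym (-‿inverseʳ (h 0))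
  sumTo-telescope (suc N) f h f≈Δh = begin
    sumTo N f + f N
      ≈⟨ +-cong (sumTo-telescope N f h (λ k k<N → f≈Δh k (ℕ.m<n⇒m<1+n k<N))) (f≈Δh N ℕ.≤-refl) ⟩
    (h N - h 0) + (h (suc N) - h N)
      ≈⟨ solve 3 (λ x y z → (x :- y) :+ (z :- x) := z :- y) refl (h N) (h 0) (h (suc N)) ⟩
    h (suc N) - h 0 ∎

  sumTo-sub : ∀ N (f g : ℕ → Carrier) → sumTo N f - sumTo N g ≈ sumTo N (λ k → f k - g k)
  sumTo-sub zero    f g = -‿inverseʳ 0#
  sumTo-sub (suc N) f g = trans
    (solve 4 (λ F G x y → (F :+ x) :- (G :+ y) := (F :- G) :+ (x :- y)) refl (sumTo N f) (sumTo N g) (f N) (g N))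
    (+-congʳ (sumTo-sub N f g))

  *-distribˡ-sumTo : ∀ x N (f : ℕ → Carrier) → x * sumTo N f ≈ sumTo N (λ k → x * f k)
  *-distribˡ-sumTo x zero    f = zeroʳ x
  *-distribˡ-sumTo x (suc N) f = trans (distribˡ x _ _) (+-congʳ (*-distribˡ-sumTo x N f))

  x≈0⇒x*y≈0 : ∀ {x y} → x ≈ 0# → x * y ≈ 0#
  x≈0⇒x*y≈0 x≈0 = trans (*-congʳ x≈0) (zeroˡ _)

  x≈0⇒-[x*y]≈0 : ∀ {x y} → x ≈ 0# → - (x * y) ≈ 0#
  x≈0⇒-[x*y]≈0 x≈0 = trans (-‿cong (x≈0⇒x*y≈0 x≈0)) -0#≈0#
    where open import Algebra.Properties.Ring ring using (-0#≈0#)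

module Division {ℓ₁ ℓ₂ : Level} (F : Field ℓ₁ ℓ₂) where
  open Field F hiding (zero)
  open IntegerCoefficientSolver commutativeRing
  open import Relation.Binary.Reasoning.Setoid setoid

  ≉0-resp-≈ : ∀ {x y} → x ≈ y → ¬ (x ≈ 0#) → ¬ (y ≈ 0#)
  ≉0-resp-≈ x≈y x≉0 y≈0 = x≉0 (trans x≈y y≈0)

  x≉0∧y≉0⇒x*y≉0 : ∀ {x y} → ¬ (x ≈ 0#) → ¬ (y ≈ 0#) → ¬ (x * y ≈ 0#)
  x≉0∧y≉0⇒x*y≉0 {x} {y} x≉0 y≉0 xy≈0 = x≉0 (begin
    x                  ≈⟨ *-identityʳ x ⟨
    x * 1#             ≈⟨ *-congˡ (⁻¹-inverse y y≉0) ⟨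
    x * (y * y ⁻¹)     ≈⟨ *-assoc x y (y ⁻¹) ⟨
    x * y * y ⁻¹       ≈⟨ *-congʳ xy≈0 ⟩
    0# * y ⁻¹          ≈⟨ zeroˡ _ ⟩
    0#                 ∎)

  x*[y*y⁻¹]≈x : ∀ x {y} → ¬ (y ≈ 0#) → x * (y * y ⁻¹) ≈ x
  x*[y*y⁻¹]≈x x {y} y≉0 = trans (*-congˡ (⁻¹-inverse y y≉0)) (*-identityʳ x)

  *-cancelˡ-≉0 : ∀ {x y z} → ¬ (x ≈ 0#) → x * y ≈ x * z → y ≈ z
  *-cancelˡ-≉0 {x} {y} {z} x≉0 xy≈xz = begin
    y                  ≈⟨ x*[y*y⁻¹]≈x y x≉0 ⟨
    y * (x * x ⁻¹)     ≈⟨ solve 3 (λ x y i → y :* (x :* i) := (x :* y) :* i) refl x y (x ⁻¹) ⟩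
    x * y * x ⁻¹       ≈⟨ *-congʳ xy≈xz ⟩
    x * z * x ⁻¹       ≈⟨ solve 3 (λ x z i → (x :* z) :* i := z :* (x :* i)) refl x z (x ⁻¹) ⟩
    z * (x * x ⁻¹)     ≈⟨ x*[y*y⁻¹]≈x z x≉0 ⟩
    z                  ∎

  cancel-denominators : ∀ {d₁ d₂ d₃ d₄} → ¬ (d₁ * d₂ ≈ 0#) → ¬ (d₃ * d₄ ≈ 0#) →
    ∀ x₁ x₂ x₃ x₄ b w p →
    (d₁ * x₁) * (d₂ * x₂) * ((d₃ * x₃) * (d₄ * x₄)) * (b * w / (d₁ * d₂) * p / (d₃ * d₄))
    ≈ b * (w * p * (x₁ * x₂) * (x₃ * x₄))
  cancel-denominators {d₁} {d₂} {d₃} {d₄} d₁d₂≉0 d₃d₄≉0 x₁ x₂ x₃ x₄ b w p = begin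
    (d₁ * x₁) * (d₂ * x₂) * ((d₃ * x₃) * (d₄ * x₄)) * (b * w * i₁₂ * p * i₃₄)
      ≈⟨ solve 13 (λ d₁ d₂ d₃ d₄ x₁ x₂ x₃ x₄ b w p i₁₂ i₃₄ →
             (d₁ :* x₁) :* (d₂ :* x₂) :* ((d₃ :* x₃) :* (d₄ :* x₄)) :* (b :* w :* i₁₂ :* p :* i₃₄)
           := b :* (w :* p :* (x₁ :* x₂) :* (x₃ :* x₄)) :* ((d₁ :* d₂ :* i₁₂) :* (d₃ :* d₄ :* i₃₄)))
           refl d₁ d₂ d₃ d₄ x₁ x₂ x₃ x₄ b w p i₁₂ i₃₄ ⟩
    b * (w * p * (x₁ * x₂) * (x₃ * x₄)) * ((d₁ * d₂ * i₁₂) * (d₃ * d₄ * i₃₄))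
      ≈⟨ *-congˡ (*-cong (⁻¹-inverse _ d₁d₂≉0) (⁻¹-inverse _ d₃d₄≉0)) ⟩
    b * (w * p * (x₁ * x₂) * (x₃ * x₄)) * (1# * 1#)
      ≈⟨ trans (*-congˡ (*-identityʳ 1#)) (*-identityʳ _) ⟩
    b * (w * p * (x₁ * x₂) * (x₃ * x₄)) ∎
    where
    i₁₂ i₃₄ : Carrier
    i₁₂ = (d₁ * d₂) ⁻¹
    i₃₄ = (d₃ * d₄) ⁻¹

module NaturalArithmetic where
  open import Data.Nat.Tactic.RingSolver using (solve-∀)

  3[1+j]²≡3j²+3j+1+[2+3j] : ∀ j → 3 ⊛ suc j ⊛ suc j ≡ (3 ⊛ j ⊛ j ⊕ 3 ⊛ j ⊕ 1) ⊕ (2 ⊕ 3 ⊛ j)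
  3[1+j]²≡3j²+3j+1+[2+3j] = solve-∀

  3[1+j]²∸[1+j]≡3j²+3j+1+[1+2j] : ∀ j →
    3 ⊛ suc j ⊛ suc j ∸ suc j ≡ (3 ⊛ j ⊛ j ⊕ 3 ⊛ j ⊕ 1) ⊕ (1 ⊕ 2 ⊛ j)
  3[1+j]²∸[1+j]≡3j²+3j+1+[1+2j] j = ≡.trans (≡.cong (_∸ suc j) (expand j)) (ℕ.m+n∸n≡m _ (suc j))
    where
    expand : ∀ j → 3 ⊛ suc j ⊛ suc j ≡ (3 ⊛ j ⊛ j ⊕ 3 ⊛ j ⊕ 1) ⊕ (1 ⊕ 2 ⊛ j) ⊕ suc j
    expand = solve-∀

  3k²+3k+1≡3k²+[1+3k] : ∀ k → 3 ⊛ k ⊛ k ⊕ 3 ⊛ k ⊕ 1 ≡ 3 ⊛ k ⊛ k ⊕ (1 ⊕ 3 ⊛ k)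
  3k²+3k+1≡3k²+[1+3k] = solve-∀

  2[m+1]≡2+2m : ∀ m → 2 ⊛ (m ⊕ 1) ≡ 2 ⊕ 2 ⊛ m
  2[m+1]≡2+2m = solve-∀

  data EvenOdd : ℕ → Set where
    even : ∀ m → EvenOdd (2 ⊛ m)
    odd  : ∀ m → EvenOdd (suc (2 ⊛ m))

  evenOrOdd : ∀ n → EvenOdd n
  evenOrOdd zero = even 0
  evenOrOdd (suc n) with evenOrOdd n
  ... | even m = odd m
  ... | odd m  = ≡.subst EvenOdd (ℕ.*-suc 2 m) (even (suc m))

open NaturalArithmetic

-- u, v, w, z play the roles of q/e, ae/c, qc/(ae), qc/e.  evenTerm n M N k and oddTerm n M N k
-- are the k-th even and odd summands multiplied by (q^n a; q)_M (q^n c; q)_N (ae; q)_n (z; q)_n.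
module ClearedIdentity {ℓ₁ ℓ₂ : Level} (F : Field ℓ₁ ℓ₂) (e v d t : Field.Carrier F) where
  open Field F hiding (zero)
  open FieldOps F
  open IntegerCoefficientSolver commutativeRing
  open QSeries F
  open import Relation.Binary.Reasoning.Setoid setoid

  q a c u w z : Carrier
  q = e * v * d
  a = v * t
  c = e * t
  u = v * d
  w = e * d
  z = e * v * d * t

  sixfold : ℕ → ℕ → Carrier
  sixfold i j = qPoch a q i * qPoch u q i * qPoch v q i * qPoch c q j * qPoch e q j * qPoch w q j

  sixfold-sucʳ : ∀ i j →
    sixfold i (suc j) ≈ sixfold i j * ((1# - pow q j * c) * (1# - pow q j * e) * (1# - pow q j * w))
  sixfold-sucʳ i j = solve 9 (λ A U V C E W c′ e′ w′ →
      A :* U :* V :* (C :* c′) :* (E :* e′) :* (W :* w′) := A :* U :* V :* C :* E :* W :* (c′ :* e′ :* w′))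
    refl (qPoch a q i) (qPoch u q i) (qPoch v q i) (qPoch c q j) (qPoch e q j) (qPoch w q j)
         (1# - pow q j * c) (1# - pow q j * e) (1# - pow q j * w)

  sixfold-suc : ∀ k → sixfold (suc k) (suc k) ≈ sixfold k k
    * ((1# - pow q k * a) * (1# - pow q k * u) * (1# - pow q k * v)
       * (1# - pow q k * c) * (1# - pow q k * e) * (1# - pow q k * w))
  sixfold-suc k = solve 12 (λ A U V C E W a′ u′ v′ c′ e′ w′ →
      A :* a′ :* (U :* u′) :* (V :* v′) :* (C :* c′) :* (E :* e′) :* (W :* w′)
      := A :* U :* V :* C :* E :* W :* (a′ :* u′ :* v′ :* c′ :* e′ :* w′))
    refl (qPoch a q k) (qPoch u q k) (qPoch v q k) (qPoch c q k) (qPoch e q k) (qPoch w q k)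
         (1# - pow q k * a) (1# - pow q k * u) (1# - pow q k * v)
         (1# - pow q k * c) (1# - pow q k * e) (1# - pow q k * w)

  restA restC : ℕ → ℕ → ℕ → Carrier
  restA n M i = qPochFrom (pow q n * a) q i M
  restC n N i = qPochFrom (pow q n * c) q i N

  restAE restZ : ℕ → ℕ → Carrier
  restAE n i = qPochFrom (a * e) q i n
  restZ  n i = qPochFrom z q i n

  evenWeight oddWeight : ℕ → Carrier
  evenWeight k = (1# - pow q (3 ⊛ k) * c) * pow q (3 ⊛ k ⊛ k ∸ k) * pow (a * c) k
  oddWeight  k = (1# - pow q (suc (3 ⊛ k)) * a) * pow q (3 ⊛ k ⊛ k ⊕ 2 ⊛ k) * pow (a * c) k

  evenTerm oddTerm bridge certificate term : ℕ → ℕ → ℕ → ℕ → Carrier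
  evenTerm n M N k = qBinom q n (2 ⊛ k)
    * (evenWeight k * sixfold k k * (restA n M k * restC n N (suc k)) * (restAE n (2 ⊛ k) * restZ n (2 ⊛ k)))
  oddTerm n M N k = qBinom q n (suc (2 ⊛ k))
    * (oddWeight k * sixfold k (suc k) * (restA n M (suc k) * restC n N (suc k))
       * (restAE n (suc (2 ⊛ k)) * restZ n (suc (2 ⊛ k))))
  bridge n M N k = qBinom q n (2 ⊛ k)
    * (a * pow q n * pow q (3 ⊛ k ⊛ k) * pow (a * c) k * sixfold k (suc k)
       * (restA (suc n) M k * restC (suc n) N (suc k)) * (restAE n (2 ⊛ k) * restZ n (2 ⊛ k)))
  certificate n M N zero    = 0#
  certificate n M N (suc k) = - (qBinom q n (suc (2 ⊛ k))
    * (pow q n * pow q (3 ⊛ k ⊛ k ⊕ 3 ⊛ k ⊕ 1) * pow (a * c) (suc k) * sixfold (suc k) (suc k)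
       * (restA (suc n) M (suc k) * restC (suc n) N (suc k)) * (restAE n (suc (2 ⊛ k)) * restZ n (suc (2 ⊛ k)))))
  term n M N k = evenTerm n M N k - a * oddTerm n M N k

  -- bridge splits the telescoping step term-step below into these two halves.
  EvenStep OddStep : ℕ → ℕ → ℕ → ℕ → Set ℓ₂
  EvenStep n M N k = evenTerm (suc n) M N k - evenTerm n (suc M) (suc N) k ≈ bridge n M N k - certificate n M N k
  OddStep  n M N k = a * oddTerm n (suc M) (suc N) k - a * oddTerm (suc n) M N k ≈ certificate n M N (suc k) - bridge n M N k

  evenTerm-step-zero-identity : ∀ x A C E Z →
      1# * (evenWeight 0 * sixfold 0 0 * (A * C) * ((E * (1# - x * (pow q 0 * (a * e)))) * (Z * (1# - x * (pow q 0 * z)))))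
    - 1# * (evenWeight 0 * sixfold 0 0 * (((1# - pow q 0 * (x * a)) * A) * ((1# - pow q 1 * (x * c)) * C)) * (E * Z))
    ≈ 1# * (a * x * pow q 0 * pow (a * c) 0 * sixfold 0 1 * (A * C) * (E * Z)) - 0#
  evenTerm-step-zero-identity = solve 9 (λ e v d t x A C E Z →
    let q = e :* v :* d ; a = v :* t ; c = e :* t ; w = e :* d ; z = e :* v :* d :* t
        weight = (:1 :- :1 :* c) :* :1 :* :1
        six₀₀ = :1 :* :1 :* :1 :* :1 :* :1 :* :1
        six₀₁ = :1 :* :1 :* :1 :* (:1 :* (:1 :- :1 :* c)) :* (:1 :* (:1 :- :1 :* e)) :* (:1 :* (:1 :- :1 :* w))
    in  :1 :* (weight :* six₀₀ :* (A :* C) :* ((E :* (:1 :- x :* (:1 :* (a :* e)))) :* (Z :* (:1 :- x :* (:1 :* z)))))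
      :- :1 :* (weight :* six₀₀ :* (((:1 :- :1 :* (x :* a)) :* A) :* ((:1 :- :1 :* q :* (x :* c)) :* C)) :* (E :* Z))
     := :1 :* (a :* x :* :1 :* :1 :* six₀₁ :* (A :* C) :* (E :* Z)) :- con (+ 0))
    refl e v d t

  evenTerm-step-zero : ∀ n M N → 1 ≤ N → EvenStep n M N 0
  evenTerm-step-zero n M N 1≤N = trans
    (+-congˡ (-‿cong (*-cong (qBinom-zero q n)
      (*-congʳ (*-congˡ (*-cong (qPochFrom-shift a q n {m = M} z≤n) (qPochFrom-shift c q n 1≤N)))))))
    (trans (evenTerm-step-zero-identity (pow q n) _ _ _ _)
      (+-congʳ (*-congʳ (sym (qBinom-zero q n)))))

  evenTerm-step-identity : ∀ x y B₀ B₁ W K P A C E Z →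
    pow y 2 * q * (1# - pow y 2 * q * q) * B₀ ≈ (pow y 2 * q - x) * B₁ →
    let ω = (1# - pow y 3 * q * q * q * c) * (W * (pow y 2 * q)) * K
        φ = (1# - y * q * c) * (1# - y * q * e) * (1# - y * q * w)
    in  (B₁ + pow y 2 * q * q * B₀) * (ω * P * (A * C) * ((E * (1# - x * (a * e))) * (Z * (1# - x * z))))
      - B₀ * (ω * P * (((1# - y * q * (x * a)) * A) * ((1# - y * q * q * (x * c)) * C)) * (E * Z))
      ≈ B₀ * (a * x * (W * (pow y 3 * q * q)) * K * (P * φ) * (A * C) * (E * Z))
      - - (B₁ * (x * W * K * P * (A * ((1# - y * q * (x * q * c)) * C))
                 * (((1# - pow y 2 * q * (a * e)) * E) * ((1# - pow y 2 * q * z) * Z))))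
  evenTerm-step-identity x y B₀ B₁ W K P A C E Z = ≈-modulo (solve 15 (λ e v d t x y B₀ B₁ W K P A C E Z →
    let q = e :* v :* d ; a = v :* t ; c = e :* t ; w = e :* d ; z = e :* v :* d :* t
        γ = :1 :- y :^ᵖ 3 :* q :* q :* q :* c
        ω = γ :* (W :* (y :^ᵖ 2 :* q)) :* K
        φ = (:1 :- y :* q :* c) :* (:1 :- y :* q :* e) :* (:1 :- y :* q :* w)
    in  (B₁ :+ y :^ᵖ 2 :* q :* q :* B₀) :* (ω :* P :* (A :* C) :* ((E :* (:1 :- x :* (a :* e))) :* (Z :* (:1 :- x :* z))))
      :- B₀ :* (ω :* P :* (((:1 :- y :* q :* (x :* a)) :* A) :* ((:1 :- y :* q :* q :* (x :* c)) :* C)) :* (E :* Z))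
     := B₀ :* (a :* x :* (W :* (y :^ᵖ 3 :* q :* q)) :* K :* (P :* φ) :* (A :* C) :* (E :* Z))
      :- :- (B₁ :* (x :* W :* K :* P :* (A :* ((:1 :- y :* q :* (x :* q :* c)) :* C))
                   :* (((:1 :- y :^ᵖ 2 :* q :* (a :* e)) :* E) :* ((:1 :- y :^ᵖ 2 :* q :* z) :* Z))))
      -- the multiplier is the coefficient of B₁ in (left - right), divided by x - y² q
      :+ (x :* (y :^ᵖ 2 :* q :* (a :* e) :* z :* γ
                :+ y :* q :* q :* c :* (:1 :- y :^ᵖ 2 :* q :* (a :* e)) :* (:1 :- y :^ᵖ 2 :* q :* z))
          :- γ)
         :* (W :* K :* P :* A :* C :* E :* Z)
         :* (y :^ᵖ 2 :* q :* (:1 :- y :^ᵖ 2 :* q :* q) :* B₀ :- (y :^ᵖ 2 :* q :- x) :* B₁))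
    refl e v d t x y B₀ B₁ W K P A C E Z)

  pow-[1+2j] : ∀ j → pow q (suc (2 ⊛ j)) ≈ pow (pow q j) 2 * q
  pow-[1+2j] j = *-congʳ (pow-* q 2 j)

  evenWeight-suc : ∀ j → evenWeight (suc j) ≈
    (1# - pow (pow q j) 3 * q * q * q * c) * (pow q (3 ⊛ j ⊛ j ⊕ 3 ⊛ j ⊕ 1) * (pow (pow q j) 2 * q)) * pow (a * c) (suc j)
  evenWeight-suc j = *-congʳ (*-cong
    (+-congˡ (-‿cong (*-congʳ (trans (reflexive (≡.cong (pow q) (ℕ.*-suc 3 j))) (*-congʳ (*-congʳ (*-congʳ (pow-* q 3 j))))))))
    (trans (reflexive (≡.cong (pow q) (3[1+j]²∸[1+j]≡3j²+3j+1+[1+2j] j)))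
           (trans (pow-+ q (3 ⊛ j ⊛ j ⊕ 3 ⊛ j ⊕ 1) (1 ⊕ 2 ⊛ j)) (*-congˡ (pow-[1+2j] j)))))

  qBinom-suc-2[1+j] : ∀ n j →
    qBinom q (suc n) (2 ⊛ suc j) ≈ qBinom q n (suc (2 ⊛ j)) + pow (pow q j) 2 * q * q * qBinom q n (2 ⊛ suc j)
  qBinom-suc-2[1+j] n j = trans (reflexive (≡.cong (qBinom q (suc n)) (ℕ.*-suc 2 j)))
    (+-congˡ (*-cong (*-congʳ (pow-[1+2j] j)) (reflexive (≡.cong (qBinom q n) (≡.sym (ℕ.*-suc 2 j))))))

  qPochFrom-sucˡ-[1+2j] : ∀ x {n} j → suc (2 ⊛ j) < n →
    qPochFrom x q (suc (2 ⊛ j)) n ≈ (1# - pow (pow q j) 2 * q * x) * qPochFrom x q (2 ⊛ suc j) n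
  qPochFrom-sucˡ-[1+2j] x {n} j 1+2j<n = trans (qPochFrom-sucˡ x q 1+2j<n)
    (*-cong (+-congˡ (-‿cong (*-congʳ (pow-[1+2j] j))))
            (reflexive (≡.cong (λ i → qPochFrom x q i n) (≡.sym (ℕ.*-suc 2 j)))))

  evenTerm-step-suc : ∀ n M N j → 2 ⊛ suc j ≤ n → suc n ≤ 2 ⊛ M → 2 ⊕ n ≤ 2 ⊛ N → EvenStep n M N (suc j)
  evenTerm-step-suc n M N j 2[1+j]≤n 1+n≤2M 2+n≤2N = trans
    (+-cong (*-cong (qBinom-suc-2[1+j] n j)
                    (*-cong (*-congʳ (*-congʳ (evenWeight-suc j)))
                            (*-cong (qPochFrom-sucʳ (a * e) q 2[1+j]≤n) (qPochFrom-sucʳ z q 2[1+j]≤n))))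
            (-‿cong (*-congˡ (*-congʳ (*-cong (*-congʳ (evenWeight-suc j))
              (*-cong (qPochFrom-shift a q n 1+j≤M) (qPochFrom-shift c q n 2+j≤N)))))))
    (trans (evenTerm-step-identity (pow q n) (pow q j) _ _ _ _ _ _ _ _ _ relation)
      (sym (+-cong (*-congˡ (*-congʳ (*-congʳ (*-cong (*-congʳ (*-congˡ cubic)) (sixfold-sucʳ (suc j) (suc j))))))
                   (-‿cong (-‿cong (*-congˡ (*-cong (*-congˡ (*-congˡ (qPochFrom-sucˡ (pow q (suc n) * c) q 2+j≤N)))
                                                     (*-cong (qPochFrom-sucˡ-[1+2j] (a * e) j 1+2j<n)
                                                             (qPochFrom-sucˡ-[1+2j] z j 1+2j<n)))))))))
    where
    1+j≤M : suc j ≤ M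
    1+j≤M = ℕ.*-cancelˡ-≤ 2 (ℕ.≤-trans 2[1+j]≤n (ℕ.≤-trans (ℕ.n≤1+n n) 1+n≤2M))
    2+j≤N : suc (suc j) ≤ N
    2+j≤N = ℕ.*-cancelˡ-≤ 2
      (ℕ.≤-trans (ℕ.≤-reflexive (ℕ.*-suc 2 (suc j))) (ℕ.≤-trans (s≤s (s≤s 2[1+j]≤n)) 2+n≤2N))
    1+2j<n : suc (2 ⊛ j) < n
    1+2j<n = ℕ.≤-trans (ℕ.≤-reflexive (≡.sym (ℕ.*-suc 2 j))) 2[1+j]≤n
    cubic : pow q (3 ⊛ suc j ⊛ suc j) ≈ pow q (3 ⊛ j ⊛ j ⊕ 3 ⊛ j ⊕ 1) * (pow (pow q j) 3 * q * q)
    cubic = trans (reflexive (≡.cong (pow q) (3[1+j]²≡3j²+3j+1+[2+3j] j)))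
                  (trans (pow-+ q (3 ⊛ j ⊛ j ⊕ 3 ⊛ j ⊕ 1) (2 ⊕ 3 ⊛ j)) (*-congˡ (*-congʳ (*-congʳ (pow-* q 3 j)))))
    relation : pow (pow q j) 2 * q * (1# - pow (pow q j) 2 * q * q) * qBinom q n (2 ⊛ suc j)
             ≈ (pow (pow q j) 2 * q - pow q n) * qBinom q n (suc (2 ⊛ j))
    relation = trans
      (sym (*-cong (*-cong (pow-[1+2j] j) (+-congˡ (-‿cong (*-congʳ (pow-[1+2j] j)))))
                   (reflexive (≡.cong (qBinom q n) (≡.sym (ℕ.*-suc 2 j))))))
      (trans (qBinom-ratio q n (suc (2 ⊛ j))) (*-congʳ (+-congʳ (pow-[1+2j] j))))

  -- When 2k = n + 1 the products restAE and restZ in the even terms are empty, and the relations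
  -- between them used in evenTerm-step-suc fail; similarly for 2k = n in the odd terms.
  evenTerm-step-boundary-identity : ∀ x y B₁ W K P A C → x ≈ pow y 2 * q →
      B₁ * ((1# - pow y 3 * q * q * q * c) * (W * (pow y 2 * q)) * K * P * (A * C) * (1# * 1#)) - 0#
    ≈ 0# - - (B₁ * (x * W * K * P * (A * ((1# - y * q * (x * q * c)) * C)) * (1# * 1#)))
  evenTerm-step-boundary-identity x y B₁ W K P A C = ≈-modulo (solve 12 (λ e v d t x y B₁ W K P A C →
    let q = e :* v :* d ; c = e :* t
    in  B₁ :* ((:1 :- y :^ᵖ 3 :* q :* q :* q :* c) :* (W :* (y :^ᵖ 2 :* q)) :* K :* P :* (A :* C) :* (:1 :* :1)) :- con (+ 0)
     := con (+ 0) :- :- (B₁ :* (x :* W :* K :* P :* (A :* ((:1 :- y :* q :* (x :* q :* c)) :* C)) :* (:1 :* :1)))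
      :+ B₁ :* W :* K :* P :* A :* C :* (y :* q :* q :* c :* (x :+ y :^ᵖ 2 :* q) :- :1) :* (x :- y :^ᵖ 2 :* q))
    refl e v d t x y B₁ W K P A C)

  evenTerm-step-boundary : ∀ n M N j → 2 ⊛ suc j ≡ suc n → suc n ≤ 2 ⊛ M → 2 ⊕ n ≤ 2 ⊛ N → EvenStep n M N (suc j)
  evenTerm-step-boundary n M N j 2[1+j]≡1+n 1+n≤2M 2+n≤2N = trans
    (+-cong (*-cong binomial (*-cong (*-congʳ (*-congʳ (evenWeight-suc j))) (*-cong (empty (a * e)) (empty z))))
            (-‿cong (x≈0⇒x*y≈0 B₀≈0)))
    (trans (evenTerm-step-boundary-identity (pow q n) (pow q j) _ _ _ _ _ _ x≈y²q)
      (sym (+-cong (x≈0⇒x*y≈0 B₀≈0)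
        (-‿cong (-‿cong (*-congˡ (*-cong (*-congˡ (*-congˡ (qPochFrom-sucˡ (pow q (suc n) * c) q 1+j<N)))
                                         (*-cong (full (a * e)) (full z)))))))))
    where
    n≡1+2j : n ≡ suc (2 ⊛ j)
    n≡1+2j = ℕ.suc-injective (≡.trans (≡.sym 2[1+j]≡1+n) (ℕ.*-suc 2 j))
    B₀≈0 : qBinom q n (2 ⊛ suc j) ≈ 0#
    B₀≈0 = n<k⇒qBinom≈0 q (ℕ.≤-reflexive (≡.sym 2[1+j]≡1+n))
    binomial : qBinom q (suc n) (2 ⊛ suc j) ≈ qBinom q n (suc (2 ⊛ j))
    binomial = trans (qBinom-suc-2[1+j] n j) (trans (+-congˡ (trans (*-congˡ B₀≈0) (zeroʳ _))) (+-identityʳ _))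
    empty : ∀ x → qPochFrom x q (2 ⊛ suc j) (suc n) ≈ 1#
    empty x = qPochFrom-empty x q (ℕ.≤-reflexive (≡.sym 2[1+j]≡1+n))
    full : ∀ x → qPochFrom x q (suc (2 ⊛ j)) n ≈ 1#
    full x = qPochFrom-empty x q (ℕ.≤-reflexive n≡1+2j)
    1+j<N : suc j < N
    1+j<N = ℕ.*-cancelˡ-< 2 (suc j) N (ℕ.≤-trans (ℕ.≤-reflexive (≡.cong suc 2[1+j]≡1+n)) 2+n≤2N)
    x≈y²q : pow q n ≈ pow (pow q j) 2 * q
    x≈y²q = trans (reflexive (≡.cong (pow q) n≡1+2j)) (pow-[1+2j] j)

  evenTerm-step-vanishing : ∀ n M N j → suc n < 2 ⊛ suc j → EvenStep n M N (suc j)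
  evenTerm-step-vanishing n M N j 1+n<2[1+j] = begin
    evenTerm (suc n) M N (suc j) - evenTerm n (suc M) (suc N) (suc j)
      ≈⟨ +-cong (x≈0⇒x*y≈0 (n<k⇒qBinom≈0 q 1+n<2[1+j])) (-‿cong (x≈0⇒x*y≈0 (n<k⇒qBinom≈0 q n<2[1+j]))) ⟩
    0# - 0#
      ≈⟨ +-cong (x≈0⇒x*y≈0 (n<k⇒qBinom≈0 q n<2[1+j])) (-‿cong (x≈0⇒-[x*y]≈0 (n<k⇒qBinom≈0 q n<1+2j))) ⟨
    bridge n M N (suc j) - certificate n M N (suc j) ∎
    where
    n<2[1+j] : n < 2 ⊛ suc j
    n<2[1+j] = ℕ.<-trans (ℕ.n<1+n n) 1+n<2[1+j]
    n<1+2j : n < suc (2 ⊛ j)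
    n<1+2j = ℕ.≤-pred (ℕ.≤-trans 1+n<2[1+j] (ℕ.≤-reflexive (ℕ.*-suc 2 j)))

  evenTerm-step : ∀ n M N k → suc n ≤ 2 ⊛ M → 2 ⊕ n ≤ 2 ⊛ N → EvenStep n M N k
  evenTerm-step n M N zero 1+n≤2M 2+n≤2N =
    evenTerm-step-zero n M N (ℕ.*-cancelˡ-≤ 2 (ℕ.≤-trans (s≤s (s≤s z≤n)) 2+n≤2N))
  evenTerm-step n M N (suc j) 1+n≤2M 2+n≤2N with ℕ.<-cmp (2 ⊛ suc j) (suc n)
  ... | tri< 2[1+j]<1+n _ _ = evenTerm-step-suc n M N j (ℕ.≤-pred 2[1+j]<1+n) 1+n≤2M 2+n≤2N
  ... | tri≈ _ 2[1+j]≡1+n _ = evenTerm-step-boundary n M N j 2[1+j]≡1+n 1+n≤2M 2+n≤2N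
  ... | tri> _ _ 1+n<2[1+j] = evenTerm-step-vanishing n M N j 1+n<2[1+j]

  oddWeight-expand : ∀ k → oddWeight k ≈ (1# - pow (pow q k) 3 * q * a) * (pow q (3 ⊛ k ⊛ k) * pow (pow q k) 2) * pow (a * c) k
  oddWeight-expand k = *-congʳ (*-cong (+-congˡ (-‿cong (*-congʳ (*-congʳ (pow-* q 3 k)))))
                                 (trans (pow-+ q (3 ⊛ k ⊛ k) (2 ⊛ k)) (*-congˡ (pow-* q 2 k))))

  qBinom-suc-[1+2k] : ∀ n k →
    qBinom q (suc n) (suc (2 ⊛ k)) ≈ qBinom q n (2 ⊛ k) + pow (pow q k) 2 * q * qBinom q n (suc (2 ⊛ k))
  qBinom-suc-[1+2k] n k = +-congˡ (*-congʳ (pow-[1+2j] k))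

  oddTerm-step-identity : ∀ x y B₀ B₁ W K P A C E Z →
    pow y 2 * (1# - pow y 2 * q) * B₁ ≈ (pow y 2 - x) * B₀ →
    let ν  = (1# - pow y 3 * q * a) * (W * pow y 2) * K
        φ₃ = (1# - y * c) * (1# - y * e) * (1# - y * w)
        φ₆ = (1# - y * a) * (1# - y * u) * (1# - y * v) * (1# - y * c) * (1# - y * e) * (1# - y * w)
    in  a * (B₁ * (ν * (P * φ₃) * (((1# - y * q * (x * a)) * A) * ((1# - y * q * (x * c)) * C)) * (E * Z)))
      - a * ((B₀ + pow y 2 * q * B₁) * (ν * (P * φ₃) * (A * C) * ((E * (1# - x * (a * e))) * (Z * (1# - x * z)))))
      ≈ - (B₁ * (x * (W * (pow y 3 * q)) * (K * (a * c)) * (P * φ₆) * (A * C) * (E * Z)))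
      - B₀ * (a * x * W * K * (P * φ₃) * (((1# - y * (x * q * a)) * A) * C)
              * (((1# - pow y 2 * (a * e)) * E) * ((1# - pow y 2 * z) * Z)))
  oddTerm-step-identity x y B₀ B₁ W K P A C E Z = ≈-modulo (solve 15 (λ e v d t x y B₀ B₁ W K P A C E Z →
    let q = e :* v :* d ; a = v :* t ; c = e :* t ; u = v :* d ; w = e :* d ; z = e :* v :* d :* t
        ν  = (:1 :- y :^ᵖ 3 :* q :* a) :* (W :* y :^ᵖ 2) :* K
        φ₃ = (:1 :- y :* c) :* (:1 :- y :* e) :* (:1 :- y :* w)
        φ₆ = (:1 :- y :* a) :* (:1 :- y :* u) :* (:1 :- y :* v) :* (:1 :- y :* c) :* (:1 :- y :* e) :* (:1 :- y :* w)
        γ  = :1 :- y :^ᵖ 3 :* q :* a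
    in  a :* (B₁ :* (ν :* (P :* φ₃) :* (((:1 :- y :* q :* (x :* a)) :* A) :* ((:1 :- y :* q :* (x :* c)) :* C)) :* (E :* Z)))
      :- a :* ((B₀ :+ y :^ᵖ 2 :* q :* B₁)
               :* (ν :* (P :* φ₃) :* (A :* C) :* ((E :* (:1 :- x :* (a :* e))) :* (Z :* (:1 :- x :* z)))))
     := :- (B₁ :* (x :* (W :* (y :^ᵖ 3 :* q)) :* (K :* (a :* c)) :* (P :* φ₆) :* (A :* C) :* (E :* Z)))
      :- B₀ :* (a :* x :* W :* K :* (P :* φ₃) :* (((:1 :- y :* (x :* q :* a)) :* A) :* C)
                :* (((:1 :- y :^ᵖ 2 :* (a :* e)) :* E) :* ((:1 :- y :^ᵖ 2 :* z) :* Z)))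
      -- the multiplier is the coefficient of B₀ in (left - right), divided by x - y²
      :+ a :* W :* K :* P :* φ₃ :* A :* C :* E :* Z
         :* (γ :- x :* y :* (q :* a :* (:1 :- y :^ᵖ 2 :* (a :* e)) :* (:1 :- y :^ᵖ 2 :* z) :+ y :* (a :* e) :* z :* γ))
         :* (y :^ᵖ 2 :* (:1 :- y :^ᵖ 2 :* q) :* B₁ :- (y :^ᵖ 2 :- x) :* B₀))
    refl e v d t x y B₀ B₁ W K P A C E Z)

  oddTerm-step-suc : ∀ n M N k → suc (2 ⊛ k) ≤ n → suc n ≤ 2 ⊛ M → 2 ⊕ n ≤ 2 ⊛ N → OddStep n M N k
  oddTerm-step-suc n M N k 1+2k≤n 1+n≤2M 2+n≤2N = trans
    (+-cong (*-congˡ (*-congˡ (*-congʳ (*-cong (*-cong (oddWeight-expand k) (sixfold-sucʳ k k))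
                                               (*-cong (qPochFrom-shift a q n 1+k≤M) (qPochFrom-shift c q n 1+k≤N))))))
            (-‿cong (*-congˡ (*-cong (qBinom-suc-[1+2k] n k)
              (*-cong (*-congʳ (*-cong (oddWeight-expand k) (sixfold-sucʳ k k)))
                      (*-cong (qPochFrom-sucʳ (a * e) q 1+2k≤n) (qPochFrom-sucʳ z q 1+2k≤n)))))))
    (trans (oddTerm-step-identity (pow q n) (pow q k) _ _ _ _ _ _ _ _ _ relation)
      (sym (+-cong (-‿cong (*-congˡ (*-congʳ (*-congʳ (*-cong (*-congʳ (*-congˡ cubic)) (sixfold-suc k))))))
                   (-‿cong (*-congˡ (*-cong (*-cong (*-congˡ (sixfold-sucʳ k k))
                                                    (*-congʳ (qPochFrom-sucˡ (pow q (suc n) * a) q 1+k≤M)))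
                                            (*-cong (peel (a * e)) (peel z))))))))
    where
    2[1+k]≤1+n : 2 ⊛ suc k ≤ suc n
    2[1+k]≤1+n = ℕ.≤-trans (ℕ.≤-reflexive (ℕ.*-suc 2 k)) (s≤s 1+2k≤n)
    1+k≤M : suc k ≤ M
    1+k≤M = ℕ.*-cancelˡ-≤ 2 (ℕ.≤-trans 2[1+k]≤1+n 1+n≤2M)
    1+k≤N : suc k ≤ N
    1+k≤N = ℕ.*-cancelˡ-≤ 2 (ℕ.≤-trans 2[1+k]≤1+n (ℕ.≤-trans (ℕ.n≤1+n (suc n)) 2+n≤2N))
    cubic : pow q (3 ⊛ k ⊛ k ⊕ 3 ⊛ k ⊕ 1) ≈ pow q (3 ⊛ k ⊛ k) * (pow (pow q k) 3 * q)
    cubic = trans (reflexive (≡.cong (pow q) (3k²+3k+1≡3k²+[1+3k] k)))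
                  (trans (pow-+ q (3 ⊛ k ⊛ k) (1 ⊕ 3 ⊛ k)) (*-congˡ (*-congʳ (pow-* q 3 k))))
    peel : ∀ x → qPochFrom x q (2 ⊛ k) n ≈ (1# - pow (pow q k) 2 * x) * qPochFrom x q (suc (2 ⊛ k)) n
    peel x = trans (qPochFrom-sucˡ x q 1+2k≤n) (*-congʳ (+-congˡ (-‿cong (*-congʳ (pow-* q 2 k)))))
    relation : pow (pow q k) 2 * (1# - pow (pow q k) 2 * q) * qBinom q n (suc (2 ⊛ k))
             ≈ (pow (pow q k) 2 - pow q n) * qBinom q n (2 ⊛ k)
    relation = trans (sym (*-congʳ (*-cong (pow-* q 2 k) (+-congˡ (-‿cong (pow-[1+2j] k))))))
                     (trans (qBinom-ratio q n (2 ⊛ k)) (*-congʳ (+-congʳ (pow-* q 2 k))))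

  oddTerm-step-boundary-identity : ∀ x y B₀ W K P A C → x ≈ pow y 2 →
    let ν  = (1# - pow y 3 * q * a) * (W * pow y 2) * K
        φ₃ = (1# - y * c) * (1# - y * e) * (1# - y * w)
    in  a * 0# - a * (B₀ * (ν * (P * φ₃) * (A * C) * (1# * 1#)))
      ≈ 0# - B₀ * (a * x * W * K * (P * φ₃) * (((1# - y * (x * q * a)) * A) * C) * (1# * 1#))
  oddTerm-step-boundary-identity x y B₀ W K P A C = ≈-modulo (solve 12 (λ e v d t x y B₀ W K P A C →
    let q = e :* v :* d ; a = v :* t ; c = e :* t ; w = e :* d
        ν  = (:1 :- y :^ᵖ 3 :* q :* a) :* (W :* y :^ᵖ 2) :* K
        φ₃ = (:1 :- y :* c) :* (:1 :- y :* e) :* (:1 :- y :* w)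
    in  a :* con (+ 0) :- a :* (B₀ :* (ν :* (P :* φ₃) :* (A :* C) :* (:1 :* :1)))
     := con (+ 0) :- B₀ :* (a :* x :* W :* K :* (P :* φ₃) :* (((:1 :- y :* (x :* q :* a)) :* A) :* C) :* (:1 :* :1))
      :+ a :* B₀ :* W :* K :* P :* φ₃ :* A :* C :* (:1 :- y :* q :* a :* (x :+ y :^ᵖ 2)) :* (x :- y :^ᵖ 2))
    refl e v d t x y B₀ W K P A C)

  oddTerm-step-boundary : ∀ n M N k → 2 ⊛ k ≡ n → suc n ≤ 2 ⊛ M → OddStep n M N k
  oddTerm-step-boundary n M N k 2k≡n 1+n≤2M = trans
    (+-cong (*-congˡ (x≈0⇒x*y≈0 B₁≈0))
            (-‿cong (*-congˡ (*-cong binomial (*-cong (*-congʳ (*-cong (oddWeight-expand k) (sixfold-sucʳ k k)))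
                                                      (*-cong (empty (a * e)) (empty z)))))))
    (trans (oddTerm-step-boundary-identity (pow q n) (pow q k) _ _ _ _ _ _ x≈y²)
      (sym (+-cong (x≈0⇒-[x*y]≈0 B₁≈0)
                   (-‿cong (*-congˡ (*-cong (*-cong (*-congˡ (sixfold-sucʳ k k))
                                                    (*-congʳ (qPochFrom-sucˡ (pow q (suc n) * a) q k<M)))
                                            (*-cong (full (a * e)) (full z))))))))
    where
    B₁≈0 : qBinom q n (suc (2 ⊛ k)) ≈ 0#
    B₁≈0 = n<k⇒qBinom≈0 q (s≤s (ℕ.≤-reflexive (≡.sym 2k≡n)))
    binomial : qBinom q (suc n) (suc (2 ⊛ k)) ≈ qBinom q n (2 ⊛ k)
    binomial = trans (+-congˡ (trans (*-congˡ B₁≈0) (zeroʳ _))) (+-identityʳ _)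
    empty : ∀ x → qPochFrom x q (suc (2 ⊛ k)) (suc n) ≈ 1#
    empty x = qPochFrom-empty x q (s≤s (ℕ.≤-reflexive (≡.sym 2k≡n)))
    full : ∀ x → qPochFrom x q (2 ⊛ k) n ≈ 1#
    full x = qPochFrom-empty x q (ℕ.≤-reflexive (≡.sym 2k≡n))
    k<M : k < M
    k<M = ℕ.*-cancelˡ-< 2 k M (ℕ.≤-trans (s≤s (ℕ.≤-reflexive 2k≡n)) 1+n≤2M)
    x≈y² : pow q n ≈ pow (pow q k) 2
    x≈y² = trans (reflexive (≡.cong (pow q) (≡.sym 2k≡n))) (pow-* q 2 k)

  oddTerm-step-vanishing : ∀ n M N k → n < 2 ⊛ k → OddStep n M N k
  oddTerm-step-vanishing n M N k n<2k = begin
    a * oddTerm n (suc M) (suc N) k - a * oddTerm (suc n) M N k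
      ≈⟨ +-cong (a*0≈0 (x≈0⇒x*y≈0 (n<k⇒qBinom≈0 q n<1+2k)))
                (-‿cong (a*0≈0 (x≈0⇒x*y≈0 (n<k⇒qBinom≈0 q (s≤s n<2k))))) ⟩
    0# - 0#
      ≈⟨ +-cong (x≈0⇒-[x*y]≈0 (n<k⇒qBinom≈0 q n<1+2k)) (-‿cong (x≈0⇒x*y≈0 (n<k⇒qBinom≈0 q n<2k))) ⟨
    certificate n M N (suc k) - bridge n M N k ∎
    where
    n<1+2k : n < suc (2 ⊛ k)
    n<1+2k = ℕ.m<n⇒m<1+n n<2k
    a*0≈0 : ∀ {x} → x ≈ 0# → a * x ≈ 0#
    a*0≈0 x≈0 = trans (*-congˡ x≈0) (zeroʳ a)

  oddTerm-step : ∀ n M N k → suc n ≤ 2 ⊛ M → 2 ⊕ n ≤ 2 ⊛ N → OddStep n M N k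
  oddTerm-step n M N k 1+n≤2M 2+n≤2N with ℕ.<-cmp (2 ⊛ k) n
  ... | tri< 2k<n _ _ = oddTerm-step-suc n M N k 2k<n 1+n≤2M 2+n≤2N
  ... | tri≈ _ 2k≡n _ = oddTerm-step-boundary n M N k 2k≡n 1+n≤2M
  ... | tri> _ _ n<2k = oddTerm-step-vanishing n M N k n<2k

  term-step : ∀ n M N k → suc n ≤ 2 ⊛ M → 2 ⊕ n ≤ 2 ⊛ N →
    term (suc n) M N k - term n (suc M) (suc N) k ≈ certificate n M N (suc k) - certificate n M N k
  term-step n M N k 1+n≤2M 2+n≤2N = begin
    term (suc n) M N k - term n (suc M) (suc N) k
      ≈⟨ solve 5 (λ E₁ E₀ O₁ O₀ a → (E₁ :- a :* O₁) :- (E₀ :- a :* O₀) := (E₁ :- E₀) :+ (a :* O₀ :- a :* O₁))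
           refl (evenTerm (suc n) M N k) (evenTerm n (suc M) (suc N) k) (oddTerm (suc n) M N k) (oddTerm n (suc M) (suc N) k) a ⟩
    (evenTerm (suc n) M N k - evenTerm n (suc M) (suc N) k) + (a * oddTerm n (suc M) (suc N) k - a * oddTerm (suc n) M N k)
      ≈⟨ +-cong (evenTerm-step n M N k 1+n≤2M 2+n≤2N) (oddTerm-step n M N k 1+n≤2M 2+n≤2N) ⟩
    (bridge n M N k - certificate n M N k) + (certificate n M N (suc k) - bridge n M N k)
      ≈⟨ solve 3 (λ I H₀ H₁ → (I :- H₀) :+ (H₁ :- I) := H₁ :- H₀)
           refl (bridge n M N k) (certificate n M N k) (certificate n M N (suc k)) ⟩
    certificate n M N (suc k) - certificate n M N k ∎

  clearedSum : ℕ → ℕ → ℕ → Carrier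
  clearedSum n M N = sumTo (suc n) (term n M N)

  clearedSum-step : ∀ n M N → suc n ≤ 2 ⊛ M → 2 ⊕ n ≤ 2 ⊛ N → clearedSum (suc n) M N ≈ clearedSum n (suc M) (suc N)
  clearedSum-step n M N 1+n≤2M 2+n≤2N = x∙y⁻¹≈ε⇒x≈y _ _ (begin
    sumTo (2 ⊕ n) (term (suc n) M N) - sumTo (suc n) (term n (suc M) (suc N))
      ≈⟨ +-congˡ (-‿cong (trans (+-congˡ term-beyond) (+-identityʳ _))) ⟨
    sumTo (2 ⊕ n) (term (suc n) M N) - sumTo (2 ⊕ n) (term n (suc M) (suc N))
      ≈⟨ sumTo-sub (2 ⊕ n) _ _ ⟩
    sumTo (2 ⊕ n) (λ k → term (suc n) M N k - term n (suc M) (suc N) k)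
      ≈⟨ sumTo-telescope (2 ⊕ n) _ (certificate n M N) (λ k _ → term-step n M N k 1+n≤2M 2+n≤2N) ⟩
    certificate n M N (2 ⊕ n) - 0#
      ≈⟨ +-congʳ (x≈0⇒-[x*y]≈0 (n<k⇒qBinom≈0 q (ℕ.m<n⇒m<1+n n<2[1+n]))) ⟩
    0# - 0#
      ≈⟨ -‿inverseʳ 0# ⟩
    0# ∎)
    where
    open import Algebra.Properties.Ring ring using (x∙y⁻¹≈ε⇒x≈y)
    n<2[1+n] : n < 2 ⊛ suc n
    n<2[1+n] = ℕ.m≤m+n (suc n) (suc n ⊕ 0)
    term-beyond : term n (suc M) (suc N) (suc n) ≈ 0#
    term-beyond = begin
      term n (suc M) (suc N) (suc n)
        ≈⟨ +-cong (x≈0⇒x*y≈0 (n<k⇒qBinom≈0 q n<2[1+n]))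
                  (-‿cong (trans (*-congˡ (x≈0⇒x*y≈0 (n<k⇒qBinom≈0 q (ℕ.m<n⇒m<1+n n<2[1+n])))) (zeroʳ a))) ⟩
      0# - 0#  ≈⟨ -‿inverseʳ 0# ⟩
      0#       ∎

  clearedSum-zero : ∀ M N → qPoch a q M * qPoch c q (suc N) ≈ clearedSum 0 M (suc N)
  clearedSum-zero M N = begin
    qPoch a q M * qPoch c q (suc N)
      ≈⟨ *-cong (qPoch-cong M (sym (trans (*-identityˡ _) (*-identityˡ a))) refl)
                (trans (qPoch-sucˡ c q N) (*-congˡ (qPoch-cong N (*-cong (sym (*-identityˡ q)) (sym (*-identityˡ c))) refl))) ⟩
    A * ((1# - c) * C)
      ≈⟨ solve 5 (λ c a A C R →
             A :* ((:1 :- c) :* C)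
          := con (+ 0) :+ (:1 :* ((:1 :- :1 :* c) :* :1 :* :1 :* (:1 :* :1 :* :1 :* :1 :* :1 :* :1) :* (A :* C) :* (:1 :* :1))
                           :- a :* (con (+ 0) :* R)))
           refl c a A C (oddWeight 0 * sixfold 0 1 * (restA 0 M 1 * restC 0 (suc N) 1) * (restAE 0 1 * restZ 0 1)) ⟩
    clearedSum 0 M (suc N) ∎
    where
    A C : Carrier
    A = qPoch (1# * (1# * a)) q M
    C = qPoch (1# * q * (1# * c)) q N

  cleared-identity : ∀ n M N → n ≤ 2 ⊛ M → suc n ≤ 2 ⊛ N → qPoch a q (n ⊕ M) * qPoch c q (n ⊕ N) ≈ clearedSum n M N
  cleared-identity zero M (suc N) _ _ = clearedSum-zero M N
  cleared-identity (suc n) M N 1+n≤2M 2+n≤2N = begin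
    qPoch a q (suc n ⊕ M) * qPoch c q (suc n ⊕ N)
      ≡⟨ ≡.cong₂ (λ i j → qPoch a q i * qPoch c q j) (≡.sym (ℕ.+-suc n M)) (≡.sym (ℕ.+-suc n N)) ⟩
    qPoch a q (n ⊕ suc M) * qPoch c q (n ⊕ suc N)
      ≈⟨ cleared-identity n (suc M) (suc N) (grow 1+n≤2M) (grow 2+n≤2N) ⟩
    clearedSum n (suc M) (suc N)
      ≈⟨ clearedSum-step n M N 1+n≤2M 2+n≤2N ⟨
    clearedSum (suc n) M N ∎
    where
    grow : ∀ {m K} → suc m ≤ 2 ⊛ K → m ≤ 2 ⊛ suc K
    grow {m} {K} 1+m≤2K = ℕ.≤-trans (ℕ.n≤1+n m) (ℕ.≤-trans 1+m≤2K (ℕ.*-monoʳ-≤ 2 (ℕ.n≤1+n K)))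

module Summands {ℓ₁ ℓ₂ : Level} (F : Field ℓ₁ ℓ₂) where
  open Field F hiding (zero)
  open FieldOps F
  open QSeries F
  open Division F

  quotient : (q a c e z : Carrier) → ℕ → Carrier
  quotient q a c e z n = (qPoch a q n * qPoch c q n) / (qPoch (a * e) q n * qPoch z q n)

  evenSummand oddSummand : (q a c e u v w z : Carrier) → ℕ → ℕ → Carrier
  evenSummand q a c e u v w z n k = qBinom q n (2 ⊛ k)
    * ((1# - pow q (3 ⊛ k) * c) * pow q (3 ⊛ k ⊛ k ∸ k) * pow (a * c) k)
    / (qPoch (pow q n * a) q k * qPoch (pow q n * c) q (k ⊕ 1))
    * (qPoch a q k * qPoch u q k * qPoch v q k * qPoch c q k * qPoch e q k * qPoch w q k)
    / (qPoch (a * e) q (2 ⊛ k) * qPoch z q (2 ⊛ k))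
  oddSummand q a c e u v w z n k = qBinom q n (2 ⊛ k ⊕ 1)
    * ((1# - pow q (3 ⊛ k ⊕ 1) * a) * pow q (3 ⊛ k ⊛ k ⊕ 2 ⊛ k) * pow (a * c) k)
    / (qPoch (pow q n * a) q (k ⊕ 1) * qPoch (pow q n * c) q (k ⊕ 1))
    * (qPoch a q k * qPoch u q k * qPoch v q k * qPoch c q (k ⊕ 1) * qPoch e q (k ⊕ 1) * qPoch w q (k ⊕ 1))
    / (qPoch (a * e) q (2 ⊛ k ⊕ 1) * qPoch z q (2 ⊛ k ⊕ 1))

  EvenDenominatorsNonzero OddDenominatorsNonzero : (q a c e z : Carrier) → ℕ → Set ℓ₂
  EvenDenominatorsNonzero q a c e z n = ∀ k → 2 ⊛ k ≤ n →
    ¬ (qPoch (pow q n * a) q k ≈ 0#) × ¬ (qPoch (pow q n * c) q (k ⊕ 1) ≈ 0#)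
    × ¬ (qPoch (a * e) q (2 ⊛ k) ≈ 0#) × ¬ (qPoch z q (2 ⊛ k) ≈ 0#)
  OddDenominatorsNonzero q a c e z n = ∀ k → 2 ⊛ k ⊕ 1 ≤ n →
    ¬ (qPoch (pow q n * a) q (k ⊕ 1) ≈ 0#) × ¬ (qPoch (pow q n * c) q (k ⊕ 1) ≈ 0#)
    × ¬ (qPoch (a * e) q (2 ⊛ k ⊕ 1) ≈ 0#) × ¬ (qPoch z q (2 ⊛ k ⊕ 1) ≈ 0#)

  module Congruence {q a c e z q′ a′ c′ e′ z′ : Carrier} (q≈q′ : q ≈ q′) (a≈a′ : a ≈ a′) (c≈c′ : c ≈ c′)
                    (e≈e′ : e ≈ e′) (z≈z′ : z ≈ z′) where

    private
      qPochₙ-cong : ∀ n x {y} m → x ≈ y → qPoch (pow q n * x) q m ≈ qPoch (pow q′ n * y) q′ m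
      qPochₙ-cong n x m x≈y = qPoch-cong m (*-cong (pow-cong n q≈q′) x≈y) q≈q′

      ae≈a′e′ : a * e ≈ a′ * e′
      ae≈a′e′ = *-cong a≈a′ e≈e′

    quotient-cong : ∀ n → quotient q a c e z n ≈ quotient q′ a′ c′ e′ z′ n
    quotient-cong n = *-cong (*-cong (qPoch-cong n a≈a′ q≈q′) (qPoch-cong n c≈c′ q≈q′))
                             (⁻¹-cong (*-cong (qPoch-cong n ae≈a′e′ q≈q′) (qPoch-cong n z≈z′ q≈q′)))

    module _ {u v w u′ v′ w′ : Carrier} (u≈u′ : u ≈ u′) (v≈v′ : v ≈ v′) (w≈w′ : w ≈ w′) where

      private
        summand-cong : ∀ {x₁ x₂ x₃ x₄ x₅ y₁ y₂ y₃ y₄ y₅} →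
          x₁ ≈ y₁ → x₂ ≈ y₂ → x₃ ≈ y₃ → x₄ ≈ y₄ → x₅ ≈ y₅ → x₁ * x₂ / x₃ * x₄ / x₅ ≈ y₁ * y₂ / y₃ * y₄ / y₅
        summand-cong x₁≈y₁ x₂≈y₂ x₃≈y₃ x₄≈y₄ x₅≈y₅ =
          *-cong (*-cong (*-cong (*-cong x₁≈y₁ x₂≈y₂) (⁻¹-cong x₃≈y₃)) x₄≈y₄) (⁻¹-cong x₅≈y₅)

        weight-cong : ∀ i j k {x y} → x ≈ y →
          (1# - pow q i * x) * pow q j * pow (a * c) k ≈ (1# - pow q′ i * y) * pow q′ j * pow (a′ * c′) k
        weight-cong i j k x≈y =
          *-cong (*-cong (+-congˡ (-‿cong (*-cong (pow-cong i q≈q′) x≈y))) (pow-cong j q≈q′)) (pow-cong k (*-cong a≈a′ c≈c′))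

        sixfold-cong : ∀ i j →
          qPoch a q i * qPoch u q i * qPoch v q i * qPoch c q j * qPoch e q j * qPoch w q j
          ≈ qPoch a′ q′ i * qPoch u′ q′ i * qPoch v′ q′ i * qPoch c′ q′ j * qPoch e′ q′ j * qPoch w′ q′ j
        sixfold-cong i j = *-cong (*-cong (*-cong (*-cong (*-cong
          (qPoch-cong i a≈a′ q≈q′) (qPoch-cong i u≈u′ q≈q′)) (qPoch-cong i v≈v′ q≈q′))
          (qPoch-cong j c≈c′ q≈q′)) (qPoch-cong j e≈e′ q≈q′)) (qPoch-cong j w≈w′ q≈q′)

      evenSummand-cong : ∀ n k → evenSummand q a c e u v w z n k ≈ evenSummand q′ a′ c′ e′ u′ v′ w′ z′ n k
      evenSummand-cong n k = summand-cong (qBinom-cong n (2 ⊛ k) q≈q′) (weight-cong (3 ⊛ k) (3 ⊛ k ⊛ k ∸ k) k c≈c′)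
        (*-cong (qPochₙ-cong n a k a≈a′) (qPochₙ-cong n c (k ⊕ 1) c≈c′)) (sixfold-cong k k)
        (*-cong (qPoch-cong (2 ⊛ k) ae≈a′e′ q≈q′) (qPoch-cong (2 ⊛ k) z≈z′ q≈q′))

      oddSummand-cong : ∀ n k → oddSummand q a c e u v w z n k ≈ oddSummand q′ a′ c′ e′ u′ v′ w′ z′ n k
      oddSummand-cong n k = summand-cong (qBinom-cong n (2 ⊛ k ⊕ 1) q≈q′) (weight-cong (3 ⊛ k ⊕ 1) (3 ⊛ k ⊛ k ⊕ 2 ⊛ k) k a≈a′)
        (*-cong (qPochₙ-cong n a (k ⊕ 1) a≈a′) (qPochₙ-cong n c (k ⊕ 1) c≈c′)) (sixfold-cong k (k ⊕ 1))
        (*-cong (qPoch-cong (2 ⊛ k ⊕ 1) ae≈a′e′ q≈q′) (qPoch-cong (2 ⊛ k ⊕ 1) z≈z′ q≈q′))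

    EvenDenominatorsNonzero-resp : ∀ n → EvenDenominatorsNonzero q a c e z n → EvenDenominatorsNonzero q′ a′ c′ e′ z′ n
    EvenDenominatorsNonzero-resp n nonzero k 2k≤n with nonzero k 2k≤n
    ... | A≉0 , C≉0 , AE≉0 , Z≉0 =
        ≉0-resp-≈ (qPochₙ-cong n a k a≈a′) A≉0 , ≉0-resp-≈ (qPochₙ-cong n c (k ⊕ 1) c≈c′) C≉0
      , ≉0-resp-≈ (qPoch-cong (2 ⊛ k) ae≈a′e′ q≈q′) AE≉0
      , ≉0-resp-≈ (qPoch-cong (2 ⊛ k) z≈z′ q≈q′) Z≉0

    OddDenominatorsNonzero-resp : ∀ n → OddDenominatorsNonzero q a c e z n → OddDenominatorsNonzero q′ a′ c′ e′ z′ n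
    OddDenominatorsNonzero-resp n nonzero k 2k+1≤n with nonzero k 2k+1≤n
    ... | A≉0 , C≉0 , AE≉0 , Z≉0 =
        ≉0-resp-≈ (qPochₙ-cong n a (k ⊕ 1) a≈a′) A≉0 , ≉0-resp-≈ (qPochₙ-cong n c (k ⊕ 1) c≈c′) C≉0
      , ≉0-resp-≈ (qPoch-cong (2 ⊛ k ⊕ 1) ae≈a′e′ q≈q′) AE≉0
      , ≉0-resp-≈ (qPoch-cong (2 ⊛ k ⊕ 1) z≈z′ q≈q′) Z≉0

module Summation {ℓ₁ ℓ₂ : Level} (F : Field ℓ₁ ℓ₂) (e v d t : Field.Carrier F) where
  open Field F hiding (zero)
  open FieldOps F
  open IntegerCoefficientSolver commutativeRing
  open QSeries F
  open Division F
  open Summands F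
  open ClearedIdentity F e v d t
  open import Relation.Binary.Reasoning.Setoid setoid

  denominator : ℕ → ℕ → ℕ → Carrier
  denominator n M N = qPoch (pow q n * a) q M * qPoch (pow q n * c) q N * (qPoch (a * e) q n * qPoch z q n)

  -- The statement writes k + 1, which does not reduce to the suc k of the cleared terms.
  qPoch-split-+1 : ∀ x {k m} → suc k ≤ m → qPoch x q m ≈ qPoch x q (k ⊕ 1) * qPochFrom x q (suc k) m
  qPoch-split-+1 x {k} 1+k≤m = trans (qPoch-split x q 1+k≤m) (*-congʳ (reflexive (≡.cong (qPoch x q) (ℕ.+-comm 1 k))))

  x≈0⇒summand≈0 : ∀ {B W D₁ P D₂} → B ≈ 0# → B * W / D₁ * P / D₂ ≈ 0#
  x≈0⇒summand≈0 B≈0 = x≈0⇒x*y≈0 (x≈0⇒x*y≈0 (x≈0⇒x*y≈0 (x≈0⇒x*y≈0 B≈0)))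

  denominator-evenSummand : ∀ n M N k → n ≤ 2 ⊛ M → suc n ≤ 2 ⊛ N → EvenDenominatorsNonzero q a c e z n →
    denominator n M N * evenSummand q a c e u v w z n k ≈ evenTerm n M N k
  denominator-evenSummand n M N k n≤2M 1+n≤2N nonzero with 2 ⊛ k ℕ.≤? n
  ... | no 2k≰n = trans (*-congˡ (x≈0⇒summand≈0 B≈0)) (trans (zeroʳ _) (sym (x≈0⇒x*y≈0 B≈0)))
    where
    B≈0 : qBinom q n (2 ⊛ k) ≈ 0#
    B≈0 = n<k⇒qBinom≈0 q (ℕ.≰⇒> 2k≰n)
  ... | yes 2k≤n with nonzero k 2k≤n
  ...   | A≉0 , C≉0 , AE≉0 , Z≉0 = trans
    (*-congʳ (*-cong (*-cong (qPoch-split _ q k≤M) (qPoch-split-+1 _ 1+k≤N))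
                     (*-cong (qPoch-split _ q 2k≤n) (qPoch-split _ q 2k≤n))))
    (cancel-denominators (x≉0∧y≉0⇒x*y≉0 A≉0 C≉0) (x≉0∧y≉0⇒x*y≉0 AE≉0 Z≉0) _ _ _ _ _ _ _)
    where
    k≤M : k ≤ M
    k≤M = ℕ.*-cancelˡ-≤ 2 (ℕ.≤-trans 2k≤n n≤2M)
    1+k≤N : suc k ≤ N
    1+k≤N = ℕ.*-cancelˡ-< 2 k N (ℕ.≤-trans (s≤s 2k≤n) 1+n≤2N)

  denominator-oddSummand : ∀ n M N k → n ≤ 2 ⊛ M → suc n ≤ 2 ⊛ N → OddDenominatorsNonzero q a c e z n →
    denominator n M N * oddSummand q a c e u v w z n k ≈ oddTerm n M N k
  denominator-oddSummand n M N k n≤2M 1+n≤2N nonzero with 2 ⊛ k ⊕ 1 ℕ.≤? n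
  ... | no 2k+1≰n = trans (*-congˡ (x≈0⇒summand≈0 (n<k⇒qBinom≈0 q n<2k+1)))
                          (trans (zeroʳ _) (sym (x≈0⇒x*y≈0 (n<k⇒qBinom≈0 q n<1+2k))))
    where
    n<2k+1 : n < 2 ⊛ k ⊕ 1
    n<2k+1 = ℕ.≰⇒> 2k+1≰n
    n<1+2k : n < suc (2 ⊛ k)
    n<1+2k = ℕ.≤-trans n<2k+1 (ℕ.≤-reflexive (ℕ.+-comm (2 ⊛ k) 1))
  ... | yes 2k+1≤n with nonzero k 2k+1≤n
  ...   | A≉0 , C≉0 , AE≉0 , Z≉0 = trans
    (*-congʳ (*-cong (*-cong (qPoch-split-+1 _ 1+k≤M) (qPoch-split-+1 _ 1+k≤N))
                     (*-cong (qPoch-split-+1 _ 1+2k≤n) (qPoch-split-+1 _ 1+2k≤n))))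
    (trans (cancel-denominators (x≉0∧y≉0⇒x*y≉0 A≉0 C≉0) (x≉0∧y≉0⇒x*y≉0 AE≉0 Z≉0) _ _ _ _ _ _ _)
      (*-cong (reflexive (≡.cong (qBinom q n) (ℕ.+-comm (2 ⊛ k) 1)))
              (*-congʳ (*-congʳ (*-cong (*-congʳ (*-congʳ (+-congˡ (-‿cong (*-congʳ (reflexive (≡.cong (pow q) 3k+1≡1+3k)))))))
                                        (reflexive (≡.cong (sixfold k) (ℕ.+-comm k 1))))))))
    where
    1+2k≤n : suc (2 ⊛ k) ≤ n
    1+2k≤n = ℕ.≤-trans (ℕ.≤-reflexive (ℕ.+-comm 1 (2 ⊛ k))) 2k+1≤n
    3k+1≡1+3k : 3 ⊛ k ⊕ 1 ≡ suc (3 ⊛ k)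
    3k+1≡1+3k = ℕ.+-comm (3 ⊛ k) 1
    1+k≤M : suc k ≤ M
    1+k≤M = ℕ.*-cancelˡ-< 2 k M (ℕ.≤-trans 1+2k≤n n≤2M)
    1+k≤N : suc k ≤ N
    1+k≤N = ℕ.*-cancelˡ-≤ 2 (ℕ.≤-trans (ℕ.≤-reflexive (ℕ.*-suc 2 k)) (ℕ.≤-trans (s≤s 1+2k≤n) 1+n≤2N))

  denominator-quotient : ∀ n M N → ¬ (qPoch (a * e) q n * qPoch z q n ≈ 0#) →
    denominator n M N * quotient q a c e z n ≈ qPoch a q (n ⊕ M) * qPoch c q (n ⊕ N)
  denominator-quotient n M N D≉0 = begin
    A * C * D * (Pa * Pc * D ⁻¹)
      ≈⟨ solve 6 (λ A C D Pa Pc I → A :* C :* D :* (Pa :* Pc :* I) := Pa :* A :* (Pc :* C) :* (D :* I))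
           refl A C D Pa Pc (D ⁻¹) ⟩
    Pa * A * (Pc * C) * (D * D ⁻¹)
      ≈⟨ trans (*-congˡ (⁻¹-inverse D D≉0)) (*-identityʳ _) ⟩
    Pa * A * (Pc * C)
      ≈⟨ *-cong (qPoch-+ a q n M) (qPoch-+ c q n N) ⟨
    qPoch a q (n ⊕ M) * qPoch c q (n ⊕ N) ∎
    where
    A C D Pa Pc : Carrier
    A = qPoch (pow q n * a) q M
    C = qPoch (pow q n * c) q N
    D = qPoch (a * e) q n * qPoch z q n
    Pa = qPoch a q n
    Pc = qPoch c q n

  summation-from-clearing : ∀ n M N → n ≤ 2 ⊛ M → suc n ≤ 2 ⊛ N →
    ¬ (qPoch (pow q n * a) q M ≈ 0#) → ¬ (qPoch (pow q n * c) q N ≈ 0#) →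
    ¬ (qPoch (a * e) q n ≈ 0#) → ¬ (qPoch z q n ≈ 0#) →
    EvenDenominatorsNonzero q a c e z n → OddDenominatorsNonzero q a c e z n →
    quotient q a c e z n ≈ sumTo (n ⊕ 1) (evenSummand q a c e u v w z n) - a * sumTo (n ⊕ 1) (oddSummand q a c e u v w z n)
  summation-from-clearing n M N n≤2M 1+n≤2N A≉0 C≉0 AE≉0 Z≉0 evenNonzero oddNonzero = *-cancelˡ-≉0 D≉0 (begin
    D * quotient q a c e z n
      ≈⟨ denominator-quotient n M N (x≉0∧y≉0⇒x*y≉0 AE≉0 Z≉0) ⟩
    qPoch a q (n ⊕ M) * qPoch c q (n ⊕ N)
      ≈⟨ cleared-identity n M N n≤2M 1+n≤2N ⟩
    sumTo (suc n) (term n M N)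
      ≈⟨ sumTo-cong (suc n) (λ k _ → +-cong (denominator-evenSummand n M N k n≤2M 1+n≤2N evenNonzero)
                                            (-‿cong (*-congˡ (denominator-oddSummand n M N k n≤2M 1+n≤2N oddNonzero)))) ⟨
    sumTo (suc n) (λ k → D * E k - a * (D * O k))
      ≈⟨ sumTo-sub (suc n) _ _ ⟨
    sumTo (suc n) (λ k → D * E k) - sumTo (suc n) (λ k → a * (D * O k))
      ≈⟨ +-cong (*-distribˡ-sumTo D (suc n) E)
                (-‿cong (trans (*-congˡ (*-distribˡ-sumTo D (suc n) O)) (*-distribˡ-sumTo a (suc n) (λ k → D * O k)))) ⟨
    D * sumTo (suc n) E - a * (D * sumTo (suc n) O)
      ≈⟨ solve 4 (λ D X a Y → D :* X :- a :* (D :* Y) := D :* (X :- a :* Y)) refl D (sumTo (suc n) E) a (sumTo (suc n) O) ⟩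
    D * (sumTo (suc n) E - a * sumTo (suc n) O)
      ≡⟨ ≡.cong (λ m → D * (sumTo m E - a * sumTo m O)) (ℕ.+-comm 1 n) ⟩
    D * (sumTo (n ⊕ 1) E - a * sumTo (n ⊕ 1) O) ∎)
    where
    D : Carrier
    D = denominator n M N
    D≉0 : ¬ (D ≈ 0#)
    D≉0 = x≉0∧y≉0⇒x*y≉0 (x≉0∧y≉0⇒x*y≉0 A≉0 C≉0) (x≉0∧y≉0⇒x*y≉0 AE≉0 Z≉0)
    E O : ℕ → Carrier
    E = evenSummand q a c e u v w z n
    O = oddSummand q a c e u v w z n

  -- Clearing with M = ⌈n/2⌉ and N = ⌊n/2⌋ + 1, the lengths whose factors the hypotheses make nonzero.
  summation : ∀ n → ¬ (qPoch (a * e) q n ≈ 0#) → ¬ (qPoch z q n ≈ 0#) →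
    EvenDenominatorsNonzero q a c e z n → OddDenominatorsNonzero q a c e z n →
    quotient q a c e z n ≈ sumTo (n ⊕ 1) (evenSummand q a c e u v w z n) - a * sumTo (n ⊕ 1) (oddSummand q a c e u v w z n)
  summation n AE≉0 Z≉0 evenNonzero oddNonzero with evenOrOdd n
  ... | even m with evenNonzero m ℕ.≤-refl
  ...   | A≉0 , C≉0 , _ = summation-from-clearing (2 ⊛ m) m (m ⊕ 1) ℕ.≤-refl
          (ℕ.≤-trans (ℕ.n≤1+n _) (ℕ.≤-reflexive (≡.sym (2[m+1]≡2+2m m)))) A≉0 C≉0 AE≉0 Z≉0 evenNonzero oddNonzero
  summation n AE≉0 Z≉0 evenNonzero oddNonzero | odd m with oddNonzero m (ℕ.≤-reflexive (ℕ.+-comm (2 ⊛ m) 1))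
  ...   | A≉0 , C≉0 , _ = summation-from-clearing (suc (2 ⊛ m)) (m ⊕ 1) (m ⊕ 1)
          (ℕ.≤-trans (ℕ.n≤1+n _) (ℕ.≤-reflexive (≡.sym (2[m+1]≡2+2m m)))) (ℕ.≤-reflexive (≡.sym (2[m+1]≡2+2m m)))
          A≉0 C≉0 AE≉0 Z≉0 evenNonzero oddNonzero

module Monomials {ℓ₁ ℓ₂ : Level} (F : Field ℓ₁ ℓ₂) (q a c e : Field.Carrier F) where
  open Field F hiding (zero)
  open IntegerCoefficientSolver commutativeRing
  open Division F

  -- The solution of q = evd, a = vt, c = et.
  v d t : Carrier
  v = a * e / c
  d = q * c / (a * e) / e
  t = c / e

  module Identities (e≉0 : ¬ (e ≈ 0#)) (c≉0 : ¬ (c ≈ 0#)) (ae≉0 : ¬ (a * e ≈ 0#)) where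

    private
      cancel-e : ∀ x → x * (e * e ⁻¹) ≈ x
      cancel-e x = x*[y*y⁻¹]≈x x e≉0
      cancel-c : ∀ x → x * (c * c ⁻¹) ≈ x
      cancel-c x = x*[y*y⁻¹]≈x x c≉0
      cancel-ae : ∀ x → x * (a * e * (a * e) ⁻¹) ≈ x
      cancel-ae x = x*[y*y⁻¹]≈x x ae≉0

    q≈evd : q ≈ e * v * d
    q≈evd = sym (trans (solve 7 (λ q a c e e′ c′ i →
        e :* (a :* e :* c′) :* (q :* c :* i :* e′) := q :* (e :* e′) :* (c :* c′) :* (a :* e :* i))
      refl q a c e (e ⁻¹) (c ⁻¹) ((a * e) ⁻¹)) (trans (cancel-ae _) (trans (cancel-c _) (cancel-e q))))

    a≈vt : a ≈ v * t
    a≈vt = sym (trans (solve 5 (λ a c e e′ c′ → a :* e :* c′ :* (c :* e′) := a :* (e :* e′) :* (c :* c′))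
      refl a c e (e ⁻¹) (c ⁻¹)) (trans (cancel-c _) (cancel-e a)))

    c≈et : c ≈ e * t
    c≈et = sym (trans (solve 3 (λ c e e′ → e :* (c :* e′) := c :* (e :* e′)) refl c e (e ⁻¹)) (cancel-e c))

    q/e≈vd : q / e ≈ v * d
    q/e≈vd = sym (trans (solve 7 (λ q a c e e′ c′ i →
        a :* e :* c′ :* (q :* c :* i :* e′) := q :* e′ :* (c :* c′) :* (a :* e :* i))
      refl q a c e (e ⁻¹) (c ⁻¹) ((a * e) ⁻¹)) (trans (cancel-ae _) (cancel-c _)))

    qc/ae≈ed : q * c / (a * e) ≈ e * d
    qc/ae≈ed = sym (trans (solve 5 (λ q c e e′ i → e :* (q :* c :* i :* e′) := q :* c :* i :* (e :* e′))
      refl q c e (e ⁻¹) ((a * e) ⁻¹)) (cancel-e _))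

    qc/e≈evdt : q * c / e ≈ e * v * d * t
    qc/e≈evdt = sym (trans (solve 7 (λ q a c e e′ c′ i →
        e :* (a :* e :* c′) :* (q :* c :* i :* e′) :* (c :* e′) := q :* c :* e′ :* (e :* e′) :* (c :* c′) :* (a :* e :* i))
      refl q a c e (e ⁻¹) (c ⁻¹) ((a * e) ⁻¹)) (trans (cancel-ae _) (trans (cancel-c _) (cancel-e _))))

proposition3 : ∀ {c ℓ : Level} (F : Field c ℓ) →
  let open Field F
      open FieldOps F
      infixl 6 _∸_
      _∸_ = Data.Nat._∸_
      infixl 7 _⊛_
      _⊛_ = Data.Nat._*_
      infixl 6 _⊕_
      _⊕_ = Data.Nat._+_
  in (q a c e : Carrier) (n : ℕ) →
     ¬ (e ≈ 0#) → ¬ (c ≈ 0#) → ¬ (a * e ≈ 0#) →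
     ¬ (qPoch (a * e) q n ≈ 0#) → ¬ (qPoch (q * c / e) q n ≈ 0#) →
     (∀ k → 2 ⊛ k ≤ n →
        ¬ (qPoch (pow q n * a) q k ≈ 0#) × ¬ (qPoch (pow q n * c) q (k ⊕ 1) ≈ 0#)
        × ¬ (qPoch (a * e) q (2 ⊛ k) ≈ 0#) × ¬ (qPoch (q * c / e) q (2 ⊛ k) ≈ 0#)) →
     (∀ k → 2 ⊛ k ⊕ 1 ≤ n →
        ¬ (qPoch (pow q n * a) q (k ⊕ 1) ≈ 0#) × ¬ (qPoch (pow q n * c) q (k ⊕ 1) ≈ 0#)
        × ¬ (qPoch (a * e) q (2 ⊛ k ⊕ 1) ≈ 0#) × ¬ (qPoch (q * c / e) q (2 ⊛ k ⊕ 1) ≈ 0#)) →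
     (qPoch a q n * qPoch c q n) / (qPoch (a * e) q n * qPoch (q * c / e) q n)
     ≈ (sumTo (n ⊕ 1) (λ k →
           qBinom q n (2 ⊛ k)
           * ((1# - pow q (3 ⊛ k) * c) * pow q (3 ⊛ k ⊛ k ∸ k) * pow (a * c) k)
           / (qPoch (pow q n * a) q k * qPoch (pow q n * c) q (k ⊕ 1))
           * (qPoch a q k * qPoch (q / e) q k * qPoch (a * e / c) q k
              * qPoch c q k * qPoch e q k * qPoch (q * c / (a * e)) q k)
           / (qPoch (a * e) q (2 ⊛ k) * qPoch (q * c / e) q (2 ⊛ k)))
        - a * sumTo (n ⊕ 1) (λ k →
           qBinom q n (2 ⊛ k ⊕ 1)
           * ((1# - pow q (3 ⊛ k ⊕ 1) * a) * pow q (3 ⊛ k ⊛ k ⊕ 2 ⊛ k) * pow (a * c) k)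
           / (qPoch (pow q n * a) q (k ⊕ 1) * qPoch (pow q n * c) q (k ⊕ 1))
           * (qPoch a q k * qPoch (q / e) q k * qPoch (a * e / c) q k
              * qPoch c q (k ⊕ 1) * qPoch e q (k ⊕ 1) * qPoch (q * c / (a * e)) q (k ⊕ 1))
           / (qPoch (a * e) q (2 ⊛ k ⊕ 1) * qPoch (q * c / e) q (2 ⊛ k ⊕ 1))))
proposition3 F q a c e n e≉0 c≉0 ae≉0 aeₙ≉0 zₙ≉0 evenNonzero oddNonzero =
  trans (quotient-cong n)
  (trans (summation n (≉0-resp-≈ (qPoch-cong n (*-congʳ a≈vt) q≈evd) aeₙ≉0)
                      (≉0-resp-≈ (qPoch-cong n qc/e≈evdt q≈evd) zₙ≉0)
                      (EvenDenominatorsNonzero-resp n evenNonzero) (OddDenominatorsNonzero-resp n oddNonzero))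
  (sym (+-cong (sumTo-cong (n ⊕ 1) (λ k _ → evenSummand-cong q/e≈vd refl qc/ae≈ed n k))
               (-‿cong (*-cong a≈vt (sumTo-cong (n ⊕ 1) (λ k _ → oddSummand-cong q/e≈vd refl qc/ae≈ed n k)))))))
  where
  open Field F hiding (zero)
  open QSeries F
  open Division F
  open Summands F
  open Monomials F q a c e
  open Identities e≉0 c≉0 ae≉0
  open Congruence q≈evd a≈vt c≈et refl qc/e≈evdt
  open Summation F e v d t
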